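{- For $d\ge0$, we have $\mathbf{T}_d\mathbf{F}_d\mathbf{T}_d^{ -1}=\mathbf{H}_d$.
   Context: Rows and columns of all matrices are indexed by $-1,0,\dots,d$. $\mathbf{T}_d=\left((-1)^{d+1+i+j}\binom{d-j}{i+1}\right)_{ -1\le i,j\le d}$ (binomial coefficients with out-of-range lower index are $0$). $\mathbf{F}_d=(f_{i,j})_{ -1\le i,j\le d}$, where for $i,j\ge0$, $f_{i,j}$ is the number of strictly increasing chains $S_0\subsetneq\cdots\subsetneq S_i$ of nonempty subsets of a fixed $(j+1)$-element set with $S_i$ the whole set, $f_{ -1,-1}=1$, $f_{ -1,j}=0$ for $j\ge0$, $f_{i,-1}=0$ for $i\ge 0$. For $n\ge1$, a permutation $\sigma$ of $[n]=\{1,\dots,n\}$ has $\mathrm{des}(\sigma)=\#\{1\le i\le n-1:\sigma(i)>\sigma(i+1)\}$, and $A(n,i,j)$ is the number of permutations $\sigma$ of $[n]$ with $\sigma(1)=j$ and $\mathrm{des}(\sigma)=i$ (with $A(n,i,j)=0$ if $i\le -1$). $\mathbf{H}_d=(h^{(d)}_{i,j})_{ -1\le i,j\le d}$ with $h^{(d)}_{i,j}=A(d+2,i+1,j+2)$. -}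

module Defs where

open import Data.Nat as ℕ using (ℕ; zero; suc; _+_; _∸_)
open import Data.Nat.Combinatorics using (_C_)
open import Data.Integer as ℤ using (ℤ; +_; -_)
open import Data.Fin as Fin using (Fin; zero; suc; toℕ; inject₁; fromℕ)
open import Data.Fin.Properties as FinP using (all?; any?)
open import Data.Fin.Subset using (Subset; Nonempty; _⊂_; ⊤)
open import Data.Fin.Subset.Properties using (nonempty?; _⊂?_)
open import Data.Bool using (Bool; true; false)
open import Data.Bool.Properties as BoolP using ()
open import Data.Vec as Vec using (Vec; []; _∷_; lookup)
open import Data.Vec.Properties as VecP using ()
open import Data.List as List using (List; []; _∷_; length; filter; map; concatMap; allFin)
open import Data.Product using (_×_; ∃; _,_)
open import Data.Product.Properties using ()
open import Relation.Nullary using (Dec; yes; no; _×-dec_; _→-dec_)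
open import Relation.Unary using (Pred; Decidable)
open import Relation.Binary.PropositionalEquality using (_≡_)
open import Level using (0ℓ)

allVecs : {A : Set} → List A → (k : ℕ) → List (Vec A k)
allVecs xs zero    = [] ∷ []
allVecs xs (suc k) = concatMap (λ x → map (x ∷_) (allVecs xs k)) xs

count : {A : Set} {P : Pred A 0ℓ} → Decidable P → List A → ℕ
count P? xs = length (filter P? xs)

allSubsets : (m : ℕ) → List (Subset m)
allSubsets m = allVecs (false ∷ true ∷ []) m

-- Square integer matrices with rows/columns indexed by Fin (d+2),
-- where the Fin index a corresponds to the paper's index a - 1
-- (so Fin (d+2) ≅ {-1,0,…,d}).

Mat : ℕ → Set
Mat n = Fin n → Fin n → ℤ

Σ : {n : ℕ} → (Fin n → ℤ) → ℤ
Σ {zero}  f = + 0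
Σ {suc n} f = f zero ℤ.+ Σ (λ k → f (suc k))

_·_ : {n : ℕ} → Mat n → Mat n → Mat n
(M · N) a b = Σ (λ k → M a k ℤ.* N k b)

Id : {n : ℕ} → Mat n
Id a b with a Fin.≟ b
... | yes _ = + 1
... | no  _ = + 0

_≡ᴹ_ : {n : ℕ} → Mat n → Mat n → Set
M ≡ᴹ N = ∀ a b → M a b ≡ N a b

sgn : ℕ → ℤ
sgn zero    = + 1
sgn (suc k) = - sgn k

-- T_d : entry (i,j) = (-1)^(d+1+i+j) * binom(d-j, i+1),
-- with i = toℕ a - 1, j = toℕ b - 1, so d+1+i+j = d + toℕ a + toℕ b - 1,
-- which has the same parity as d + toℕ a + toℕ b + 1;
-- d - j = d + 1 - toℕ b ≥ 0 and i + 1 = toℕ a.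
-- (ℕ binomial _C_ is 0 when the lower index exceeds the upper one.)

T : (d : ℕ) → Mat (suc (suc d))
T d a b = sgn (d + toℕ a + toℕ b + 1) ℤ.* + ((suc d ∸ toℕ b) C toℕ a)

IsChain : {m i : ℕ} → Vec (Subset m) (suc i) → Set
IsChain {m} {i} c =
  (∀ k → Nonempty (lookup c k)) ×
  ((∀ (k : Fin i) → lookup c (inject₁ k) ⊂ lookup c (suc k)) ×
   (lookup c (fromℕ i) ≡ ⊤))

isChain? : {m i : ℕ} → Decidable (IsChain {m} {i})
isChain? {m} {i} c =
  all? (λ k → nonempty? (lookup c k)) ×-dec
  (all? (λ k → lookup c (inject₁ k) ⊂? lookup c (suc k)) ×-dec
   VecP.≡-dec BoolP._≟_ (lookup c (fromℕ i)) ⊤)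

chains : (i m : ℕ) → ℕ
chains i m = count (isChain? {m} {i}) (allVecs (allSubsets m) (suc i))

F : (d : ℕ) → Mat (suc (suc d))
F d zero    zero    = + 1
F d zero    (suc b) = + 0
F d (suc a) zero    = + 0
F d (suc a) (suc b) = + chains (toℕ a) (suc (toℕ b))

-- σ of [n] encoded as the vector (σ(1)-1, …, σ(n)-1) over Fin n;
-- it is a permutation iff the map is a bijection.
IsPerm : {n : ℕ} → Vec (Fin n) n → Set
IsPerm {n} v =
  (∀ a b → lookup v a ≡ lookup v b → a ≡ b) × (∀ y → ∃ λ x → lookup v x ≡ y)

isPerm? : {n : ℕ} → Decidable (IsPerm {n})
isPerm? {n} v =
  all? (λ a → all? (λ b → (lookup v a Fin.≟ lookup v b) →-dec (a Fin.≟ b))) ×-dec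
  all? (λ y → any? (λ x → lookup v x Fin.≟ y))

des : {m : ℕ} → Vec (Fin (suc m)) (suc m) → ℕ
des {m} v = count (λ k → lookup v (suc k) Fin.<? lookup v (inject₁ k)) (allFin m)

PermWith : (m i j : ℕ) → Vec (Fin (suc m)) (suc m) → Set
PermWith m i j v = IsPerm v × ((suc (toℕ (lookup v zero)) ≡ j) × (des v ≡ i))

permWith? : (m i j : ℕ) → Decidable (PermWith m i j)
permWith? m i j v = isPerm? v ×-dec ((suc (toℕ (lookup v zero)) ℕ.≟ j) ×-dec (des v ℕ.≟ i))

A : (n i j : ℕ) → ℕ
A zero    i j = 0
A (suc m) i j = count (permWith? m i j) (allVecs (allFin (suc m)) (suc m))

-- h_{i,j} = A(d+2, i+1, j+2) with i = toℕ a - 1, j = toℕ b - 1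
H : (d : ℕ) → Mat (suc (suc d))
H d a b = + A (suc (suc d)) (toℕ a) (suc (toℕ b))

module Submission where

-- In the 0-based indices a, b of Defs, T_d⁻¹ has entries C(b, d+1−a): this is binomial inversion,
-- i.e. Σ_c (−1)^c C(b,c) C(c,a) = 0 for a ≠ b.  So it suffices to show F_d T_d⁻¹ = T_d⁻¹ H_d.
-- A chain S_0 ⊊ ⋯ ⊊ S_i = [j+1] is an ordered partition of [j+1] into the blocks S_0, S_1 ∖ S_0, …,
-- so f_{i,j} counts surjections [j+1] → [i+1].  With N = d+1, entry (k,a) of F_d T_d⁻¹ is
-- L_N(a,k) = Σ_b surj(b,k) C(a,N−b), and entry (k,a) of T_d⁻¹ H_d is R_N(a,N−k), where
-- R_N(a,m) = Σ_i C(i,m) A(N+1,i,a+1).  Removing the first letter of a permutation and standardising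
-- the rest gives R_{N+1}(a,m) = Σ_{y≤N} R_N(y,m) + Σ_{y<a} R_N(y,m−1); the hockey-stick identity gives
-- L_{N+1}(a,k) = surj(N+1,k) + Σ_{y<a} L_N(y,k), and the recurrence of surjection numbers gives
-- Σ_{y≤N} L_N(y,k) = surj(N+1,k+1).  Hence R_N(a,N−k) = L_N(a,k) by induction on N.

open import Defs
open import Data.Nat using (ℕ; suc)

open import Algebra.Bundles using (CommutativeSemiring)
open import Data.Bool using (if_then_else_)
open import Data.Fin using (Fin; suc; toℕ; punchIn)
import Data.Fin.Properties as FinP
open import Data.Nat as ℕ using (zero; _∸_; _≤_; _<_; z≤n; s≤s)
open import Data.Nat.Combinatorics using (_C_; nCk+nC[k+1]≡[n+1]C[k+1]; nCk≡nC[n∸k])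
open import Data.Nat.Combinatorics.Specification using (k>n⇒nCk≡0)
import Data.Nat.Properties as ℕP
open import Function using (_∘_)
open import Relation.Binary.Bundles using (Setoid)
import Relation.Binary.PropositionalEquality as ≡
open ≡ using (_≢_; cong)
open import Relation.Nullary using (does)
open import Relation.Nullary.Decidable using (dec-true; dec-false)

module FiniteSums {c ℓ} (R : CommutativeSemiring c ℓ) where

  open CommutativeSemiring R hiding (refl; sym; trans)
  open Setoid setoid using () renaming (refl to ≈-refl; sym to ≈-sym; trans to ≈-trans)
  open import Algebra.Properties.Semiring.Sum semiring public
    using ( sum; sum-cong-≋; sum-remove; ∑-comm; ∑-distrib-+; *-distribˡ-sum; *-distribʳ-sum
          ; sum-init-last; sum-replicate-zero)
  open import Algebra.Properties.Monoid.Mult +-monoid public using (_×_)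
  open import Algebra.Properties.Monoid.Mult +-monoid using (×-homo-0; ×-homo-+; ×-congˡ)
  open import Algebra.Properties.CommutativeSemigroup +-commutativeSemigroup
    using (x∙yz≈y∙xz) renaming (interchange to +-interchange)
  open import Relation.Binary.Reasoning.Setoid setoid

  sum-pick : ∀ {n} (a : Fin (suc n)) (δ f : Fin (suc n) → Carrier) →
             δ a ≈ 1# → (∀ k → k ≢ a → δ k ≈ 0#) → sum (λ k → δ k * f k) ≈ f a
  sum-pick {n} a δ f δa≈1 δk≈0 = begin
    sum (λ k → δ k * f k)                                      ≈⟨ sum-remove {i = a} (λ k → δ k * f k) ⟩
    δ a * f a + sum (λ k → δ (punchIn a k) * f (punchIn a k))  ≈⟨ +-cong a-term others-vanish ⟩
    f a + 0#                                                   ≈⟨ +-identityʳ (f a) ⟩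
    f a                                                        ∎
    where
    a-term = ≈-trans (*-congʳ δa≈1) (*-identityˡ (f a))
    others-vanish = ≈-trans
      (sum-cong-≋ {n} (λ k → ≈-trans (*-congʳ (δk≈0 (punchIn a k) (FinP.punchInᵢ≢i a k)))
                                      (zeroˡ (f (punchIn a k)))))
      (sum-replicate-zero n)

  ∑< : ℕ → (ℕ → Carrier) → Carrier
  ∑< n f = sum {n} (f ∘ toℕ)

  ∑<-cong : ∀ n {f g : ℕ → Carrier} → (∀ i → i < n → f i ≈ g i) → ∑< n f ≈ ∑< n g
  ∑<-cong n f≈g = sum-cong-≋ {n} (λ i → f≈g (toℕ i) (FinP.toℕ<n i))

  ∑<-zero : ∀ n (f : ℕ → Carrier) → (∀ i → i < n → f i ≈ 0#) → ∑< n f ≈ 0#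
  ∑<-zero n f f≈0 = ≈-trans (∑<-cong n f≈0) (sum-replicate-zero n)

  ∑<-distrib-+ : ∀ n (f g : ℕ → Carrier) → ∑< n (λ i → f i + g i) ≈ ∑< n f + ∑< n g
  ∑<-distrib-+ n f g = ∑-distrib-+ {n} (f ∘ toℕ) (g ∘ toℕ)

  *-distribˡ-∑< : ∀ n x (f : ℕ → Carrier) → ∑< n (λ i → x * f i) ≈ x * ∑< n f
  *-distribˡ-∑< n x f = ≈-sym (*-distribˡ-sum {n} x (f ∘ toℕ))

  ∑<-comm : ∀ m n (f : ℕ → ℕ → Carrier) →
            ∑< m (λ i → ∑< n (λ j → f i j)) ≈ ∑< n (λ j → ∑< m (λ i → f i j))
  ∑<-comm m n f = ∑-comm {m} {n} (λ i j → f (toℕ i) (toℕ j))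

  ∑<-snoc : ∀ n (f : ℕ → Carrier) → ∑< (suc n) f ≈ ∑< n f + f n
  ∑<-snoc n f = ≈-trans (sum-init-last {n} (f ∘ toℕ))
    (+-cong (sum-cong-≋ {n} (λ i → reflexive (cong f (FinP.toℕ-inject₁ i))))
            (reflexive (cong f (FinP.toℕ-fromℕ n))))

  ∑<-extend : ∀ n k (f : ℕ → Carrier) → (∀ i → n ≤ i → f i ≈ 0#) → ∑< (k ℕ.+ n) f ≈ ∑< n f
  ∑<-extend n zero    f f≈0 = ≈-refl
  ∑<-extend n (suc k) f f≈0 = begin
    ∑< (suc (k ℕ.+ n)) f          ≈⟨ ∑<-snoc (k ℕ.+ n) f ⟩
    ∑< (k ℕ.+ n) f + f (k ℕ.+ n)  ≈⟨ +-cong (∑<-extend n k f f≈0) (f≈0 (k ℕ.+ n) (ℕP.m≤n+m n k)) ⟩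
    ∑< n f + 0#                   ≈⟨ +-identityʳ _ ⟩
    ∑< n f                        ∎

  ∑<-reverse : ∀ n (f : ℕ → Carrier) → ∑< (suc n) f ≈ ∑< (suc n) (λ i → f (n ∸ i))
  ∑<-reverse zero    f = ≈-refl
  ∑<-reverse (suc n) f = begin
    ∑< (suc (suc n)) f                        ≈⟨ ∑<-snoc (suc n) f ⟩
    ∑< (suc n) f + f (suc n)                  ≈⟨ +-congʳ (∑<-reverse n f) ⟩
    ∑< (suc n) (λ i → f (n ∸ i)) + f (suc n)  ≈⟨ +-comm _ _ ⟩
    ∑< (suc (suc n)) (λ i → f (suc n ∸ i))    ∎

  ∑<-if-< : ∀ n a (f : ℕ → Carrier) → a ≤ n →
            ∑< n (λ y → if does (y ℕ.<? a) then f y else 0#) ≈ ∑< a f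
  ∑<-if-< n a f a≤n = begin
    ∑< n g                ≡⟨ cong (λ n → ∑< n g) (≡.sym (ℕP.m∸n+n≡m a≤n)) ⟩
    ∑< ((n ∸ a) ℕ.+ a) g  ≈⟨ ∑<-extend a (n ∸ a) g (λ y a≤y → reflexive (g-≥ y a≤y)) ⟩
    ∑< a g                ≈⟨ ∑<-cong a (λ y y<a → reflexive (g-< y y<a)) ⟩
    ∑< a f                ∎
    where
    g = λ y → if does (y ℕ.<? a) then f y else 0#
    g-≥ : ∀ y → a ≤ y → g y ≡.≡ 0#
    g-≥ y a≤y = cong (if_then f y else 0#) (dec-false (y ℕ.<? a) (ℕP.≤⇒≯ a≤y))
    g-< : ∀ y → y < a → g y ≡.≡ f y
    g-< y y<a = cong (if_then f y else 0#) (dec-true (y ℕ.<? a) y<a)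

  -- Σ_{b≤r} C(r,b) f(b) (binomialSum-closed), computed by splitting off one of r points: this is
  -- the recursion followed by a sum over the supersets of a set that misses r points.
  binomialSum : ℕ → (ℕ → Carrier) → Carrier
  binomialSum zero    f = f 0
  binomialSum (suc r) f = binomialSum r (f ∘ suc) + binomialSum r f

  properBinomialSum : ℕ → (ℕ → Carrier) → Carrier
  properBinomialSum zero    f = 0#
  properBinomialSum (suc r) f = properBinomialSum r (f ∘ suc) + binomialSum r f

  binomialSum-cong : ∀ r {f g : ℕ → Carrier} → (∀ i → f i ≈ g i) → binomialSum r f ≈ binomialSum r g
  binomialSum-cong zero    f≈g = f≈g 0
  binomialSum-cong (suc r) f≈g = +-cong (binomialSum-cong r (f≈g ∘ suc)) (binomialSum-cong r f≈g)

  binomialSum-distrib-+ : ∀ r (f g : ℕ → Carrier) →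
                          binomialSum r (λ i → f i + g i) ≈ binomialSum r f + binomialSum r g
  binomialSum-distrib-+ zero    f g = ≈-refl
  binomialSum-distrib-+ (suc r) f g = ≈-trans
    (+-cong (binomialSum-distrib-+ r (f ∘ suc) (g ∘ suc)) (binomialSum-distrib-+ r f g))
    (+-interchange _ _ _ _)

  binomialSum-split : ∀ r (f : ℕ → Carrier) → binomialSum r f ≈ f r + properBinomialSum r f
  binomialSum-split zero    f = ≈-sym (+-identityʳ (f 0))
  binomialSum-split (suc r) f = ≈-trans (+-congʳ (binomialSum-split r (f ∘ suc))) (+-assoc _ _ _)

  binomialSum-zero : ∀ r (f : ℕ → Carrier) → (∀ u → u ≤ r → f u ≈ 0#) → binomialSum r f ≈ 0#
  binomialSum-zero zero    f f≈0 = f≈0 0 z≤n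
  binomialSum-zero (suc r) f f≈0 = ≈-trans
    (+-cong (binomialSum-zero r (f ∘ suc) (λ u u≤r → f≈0 (suc u) (s≤s u≤r)))
            (binomialSum-zero r f (λ u u≤r → f≈0 u (ℕP.m≤n⇒m≤1+n u≤r))))
    (+-identityʳ 0#)

  properBinomialSum-zero : ∀ r (f : ℕ → Carrier) → (∀ u → u < r → f u ≈ 0#) →
                           properBinomialSum r f ≈ 0#
  properBinomialSum-zero zero    f f≈0 = ≈-refl
  properBinomialSum-zero (suc r) f f≈0 = ≈-trans
    (+-cong (properBinomialSum-zero r (f ∘ suc) (λ u u<r → f≈0 (suc u) (s≤s u<r)))
            (binomialSum-zero r f (λ u u≤r → f≈0 u (s≤s u≤r))))
    (+-identityʳ 0#)

  binomialSum-closed : ∀ r (f : ℕ → Carrier) → binomialSum r f ≈ ∑< (suc r) (λ b → (r C b) × f b)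
  binomialSum-closed zero    f = ≈-sym (≈-trans (+-identityʳ _) (+-identityʳ (f 0)))
  binomialSum-closed (suc r) f = begin
    binomialSum r (f ∘ suc) + binomialSum r f
      ≈⟨ +-cong (binomialSum-closed r (f ∘ suc)) (binomialSum-closed r f) ⟩
    S + (1 × f 0 + ∑< r (λ b → (r C suc b) × f (suc b)))
      ≈⟨ x∙yz≈y∙xz _ _ _ ⟩
    1 × f 0 + (S + ∑< r (λ b → (r C suc b) × f (suc b)))
      ≈⟨ +-congˡ (+-congˡ (≈-sym last-vanishes)) ⟩
    1 × f 0 + (S + ∑< (suc r) (λ b → (r C suc b) × f (suc b)))
      ≈⟨ +-congˡ (≈-sym (∑<-distrib-+ (suc r) (λ b → (r C b) × f (suc b))
                                               (λ b → (r C suc b) × f (suc b)))) ⟩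
    1 × f 0 + ∑< (suc r) (λ b → (r C b) × f (suc b) + (r C suc b) × f (suc b))
      ≈⟨ +-congˡ (∑<-cong (suc r) (λ b _ → pascal b)) ⟩
    1 × f 0 + ∑< (suc r) (λ b → (suc r C suc b) × f (suc b)) ∎
    where
    S = ∑< (suc r) (λ b → (r C b) × f (suc b))
    pascal : ∀ b → (r C b) × f (suc b) + (r C suc b) × f (suc b) ≈ (suc r C suc b) × f (suc b)
    pascal b = ≈-trans (≈-sym (×-homo-+ (f (suc b)) (r C b) (r C suc b)))
                       (×-congˡ (nCk+nC[k+1]≡[n+1]C[k+1] r b))
    last-vanishes : ∑< (suc r) (λ b → (r C suc b) × f (suc b)) ≈ ∑< r (λ b → (r C suc b) × f (suc b))
    last-vanishes = ≈-trans (∑<-snoc r (λ b → (r C suc b) × f (suc b)))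
      (≈-trans (+-congˡ (≈-trans (×-congˡ {f (suc r)} (k>n⇒nCk≡0 (ℕP.n<1+n r))) (×-homo-0 (f (suc r)))))
               (+-identityʳ _))

open import Data.Bool using (true; false)
import Data.Bool.Properties as BoolP
open import Data.Fin as Fin using (zero; inject₁; fromℕ<; punchOut)
open import Data.Fin.Subset using (Subset; Nonempty; _⊂_; _⊆_; _∉_; ⊤) renaming (⊥ to ∅)
open import Data.Fin.Subset.Properties
  using (_⊂?_; _⊆?_; out⊆-⇔; in⊆in-⇔; out⊂out-⇔; out⊂in-⇔; in⊂in-⇔; ∉⊥; ⊥⊆)
import Data.Integer.Properties as ℤP
open import Data.List as List using (List; []; _∷_; _++_; map; allFin; tabulate; concatMap)
import Data.List.Properties as ListP
import Data.List.Relation.Unary.All as All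
open import Data.Product using (Σ-syntax; _×_; _,_; proj₁; proj₂; ∃)
open import Data.Sum using (inj₁; inj₂)
open import Data.Vec as Vec using (Vec; []; _∷_; lookup; here)
import Data.Vec.Properties as VecP
open import Function.Bundles using (_⇔_; mk⇔; Equivalence)
import Function.Properties.Equivalence as Equiv
open import Level using (Level)
open import Relation.Binary.PropositionalEquality
  using (_≡_; refl; sym; trans; cong₂; subst; module ≡-Reasoning)
open import Relation.Nullary using (Dec; yes; no; ¬_; ¬?; _×-dec_; contradiction)
open import Relation.Unary using (Pred; Decidable)

module ℕ∑ = FiniteSums ℕP.+-*-commutativeSemiring
module ℤ∑ = FiniteSums ℤP.+-*-commutativeSemiring

module Counting where

  open import Data.Nat using (_+_; _*_)
  import Data.Nat.ListAction as ℕList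
  import Data.Nat.ListAction.Properties as ℕListP
  open import Algebra.Properties.CommutativeSemigroup ℕP.*-commutativeSemigroup
    using () renaming (x∙yz≈y∙xz to *-x∙yz≈y∙xz)
  open ℕ∑ hiding (_×_)

  private
    variable
      p q : Level
      P : Set p
      Q : Set q
      X Y : Set

  𝟙 : Dec P → ℕ
  𝟙 (yes _) = 1
  𝟙 (no _)  = 0

  𝟙-⇔ : (P? : Dec P) (Q? : Dec Q) → P ⇔ Q → 𝟙 P? ≡ 𝟙 Q?
  𝟙-⇔ (yes _) (yes _) _   = refl
  𝟙-⇔ (yes p) (no ¬q) P⇔Q = contradiction (Equivalence.to P⇔Q p) ¬q
  𝟙-⇔ (no ¬p) (yes q) P⇔Q = contradiction (Equivalence.from P⇔Q q) ¬p
  𝟙-⇔ (no _)  (no _)  _   = refl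

  𝟙-yes : (P? : Dec P) → P → 𝟙 P? ≡ 1
  𝟙-yes (yes _) _ = refl
  𝟙-yes (no ¬p) p = contradiction p ¬p

  𝟙-no : (P? : Dec P) → ¬ P → 𝟙 P? ≡ 0
  𝟙-no (yes p) ¬p = contradiction p ¬p
  𝟙-no (no _)  _  = refl

  𝟙≤1 : (P? : Dec P) → 𝟙 P? ≤ 1
  𝟙≤1 (yes _) = s≤s z≤n
  𝟙≤1 (no _)  = z≤n

  𝟙-×-dec : (P? : Dec P) (Q? : Dec Q) → 𝟙 (P? ×-dec Q?) ≡ 𝟙 P? * 𝟙 Q?
  𝟙-×-dec (yes _) (yes _) = refl
  𝟙-×-dec (yes _) (no _)  = refl
  𝟙-×-dec (no _)  (yes _) = refl
  𝟙-×-dec (no _)  (no _)  = refl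

  ∑∈ : List X → (X → ℕ) → ℕ
  ∑∈ xs g = ℕList.sum (map g xs)

  infixl 10 ∑∈
  syntax ∑∈ xs (λ x → e) = ∑[ x ∈ xs ] e

  count≡∑𝟙 : {P : Pred X Level.zero} (P? : Decidable P) (xs : List X) →
             count P? xs ≡ ∑[ x ∈ xs ] 𝟙 (P? x)
  count≡∑𝟙 P? []       = refl
  count≡∑𝟙 P? (x ∷ xs) with P? x
  ... | yes _ = cong suc (count≡∑𝟙 P? xs)
  ... | no  _ = count≡∑𝟙 P? xs

  count-none : {P : Pred X Level.zero} (P? : Decidable P) (xs : List X) → (∀ x → ¬ P x) →
               count P? xs ≡ 0
  count-none P? xs ¬P = cong List.length (ListP.filter-none P? (All.universal ¬P xs))

  ∑∈-cong : (xs : List X) {f g : X → ℕ} → (∀ x → f x ≡ g x) → ∑∈ xs f ≡ ∑∈ xs g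
  ∑∈-cong xs f≗g = cong ℕList.sum (ListP.map-cong f≗g xs)

  ∑∈-zero : (xs : List X) (f : X → ℕ) → (∀ x → f x ≡ 0) → ∑∈ xs f ≡ 0
  ∑∈-zero []       f f≗0 = refl
  ∑∈-zero (x ∷ xs) f f≗0 rewrite f≗0 x = ∑∈-zero xs f f≗0

  ∑∈-++ : (xs ys : List X) (f : X → ℕ) → ∑∈ (xs ++ ys) f ≡ ∑∈ xs f + ∑∈ ys f
  ∑∈-++ xs ys f = trans (cong ℕList.sum (ListP.map-++ f xs ys)) (ℕListP.sum-++ (map f xs) (map f ys))

  ∑∈-map : (h : Y → X) (ys : List Y) (f : X → ℕ) → ∑∈ (map h ys) f ≡ ∑∈ ys (f ∘ h)
  ∑∈-map h ys f = cong ℕList.sum (sym (ListP.map-∘ ys))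

  *-distribˡ-∑∈ : (xs : List X) (c : ℕ) (f : X → ℕ) → ∑[ x ∈ xs ] (c * f x) ≡ c * ∑∈ xs f
  *-distribˡ-∑∈ []       c f = sym (ℕP.*-zeroʳ c)
  *-distribˡ-∑∈ (x ∷ xs) c f rewrite *-distribˡ-∑∈ xs c f = sym (ℕP.*-distribˡ-+ c (f x) _)

  ∑∈-∑<-comm : (xs : List X) (n : ℕ) (f : ℕ → X → ℕ) →
               ∑[ x ∈ xs ] ∑< n (λ y → f y x) ≡ ∑< n (λ y → ∑[ x ∈ xs ] f y x)
  ∑∈-∑<-comm []       n f = sym (∑<-zero n _ (λ _ _ → refl))
  ∑∈-∑<-comm (x ∷ xs) n f = trans (cong (∑< n (λ y → f y x) +_) (∑∈-∑<-comm xs n f))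
                                  (sym (∑<-distrib-+ n (λ y → f y x) (λ y → ∑∈ xs (f y))))

  ∑∈-allFin : ∀ n (g : Fin n → ℕ) → ∑[ x ∈ allFin n ] g x ≡ sum g
  ∑∈-allFin n g = trans (cong ℕList.sum (ListP.map-tabulate (λ x → x) g)) (∑-tabulate n g)
    where
    ∑-tabulate : ∀ n (h : Fin n → ℕ) → ℕList.sum (tabulate h) ≡ sum h
    ∑-tabulate zero    h = refl
    ∑-tabulate (suc n) h = cong (h zero +_) (∑-tabulate n (h ∘ suc))

  ∑∈-allVecs-suc : (xs : List X) (k : ℕ) (f : Vec X (suc k) → ℕ) →
                   ∑∈ (allVecs xs (suc k)) f ≡ ∑[ x ∈ xs ] ∑[ v ∈ allVecs xs k ] f (x ∷ v)
  ∑∈-allVecs-suc xs k f = go xs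
    where
    go : ∀ ys → ∑∈ (concatMap (λ x → map (x Vec.∷_) (allVecs xs k)) ys) f
               ≡ ∑[ x ∈ ys ] ∑[ v ∈ allVecs xs k ] f (x ∷ v)
    go []       = refl
    go (y ∷ ys) = trans (∑∈-++ (map (y Vec.∷_) (allVecs xs k)) _ f)
                        (cong₂ _+_ (∑∈-map (y Vec.∷_) (allVecs xs k) f) (go ys))

  ×≡* : ∀ n x → n ℕ∑.× x ≡ n * x
  ×≡* zero    x = refl
  ×≡* (suc n) x = cong (x +_) (×≡* n x)

  binomialSum≡∑C : ∀ r (f : ℕ → ℕ) → binomialSum r f ≡ ∑< (suc r) (λ b → (r C b) * f b)
  binomialSum≡∑C r f = trans (binomialSum-closed r f) (∑<-cong (suc r) (λ b _ → ×≡* (r C b) (f b)))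

  ∑<-C : ∀ a j → ∑< a (λ y → y C j) ≡ a C suc j
  ∑<-C zero    j = refl
  ∑<-C (suc a) j = begin
    ∑< (suc a) (λ y → y C j)    ≡⟨ ∑<-snoc a (λ y → y C j) ⟩
    ∑< a (λ y → y C j) + a C j  ≡⟨ cong (_+ a C j) (∑<-C a j) ⟩
    a C suc j + a C j           ≡⟨ ℕP.+-comm (a C suc j) (a C j) ⟩
    a C j + a C suc j           ≡⟨ nCk+nC[k+1]≡[n+1]C[k+1] a j ⟩
    suc a C suc j               ∎
    where open ≡-Reasoning

  -- surjections r k counts the surjections [r] → [k]: a surjection onto [k+1] is determined by the
  -- u < r points not sent to k+1, chosen in r C u ways, and a surjection of them onto [k].
  surjections : ℕ → ℕ → ℕ
  surjections r       (suc k) = properBinomialSum r (λ u → surjections u k)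
  surjections zero    zero    = 1
  surjections (suc r) zero    = 0

  surjections-zero : ∀ r → surjections r 0 ≡ 𝟙 (r ℕ.≟ 0)
  surjections-zero zero    = refl
  surjections-zero (suc r) = refl

  surjections-< : ∀ {r k} → r < k → surjections r k ≡ 0
  surjections-< {r} {suc k} (s≤s r≤k) = properBinomialSum-zero r (λ u → surjections u k)
    (λ u u<r → surjections-< (ℕP.<-≤-trans u<r r≤k))

  -- Entry (k, a) of F_d T_d⁻¹, for N = d + 1.
  binomialSurjections : ℕ → ℕ → ℕ → ℕ
  binomialSurjections N a k = ∑< (suc N) (λ b → surjections b k * (a C (N ∸ b)))

  binomialSurjections-top : ∀ N a → binomialSurjections N a (suc N) ≡ 0
  binomialSurjections-top N a =
    ∑<-zero (suc N) _ (λ b b≤N → cong (_* (a C (N ∸ b))) (surjections-< b≤N))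

  binomialSurjections-suc : ∀ N a k →
    binomialSurjections (suc N) a k ≡ surjections (suc N) k + ∑< a (λ y → binomialSurjections N y k)
  binomialSurjections-suc N a k = begin
    ∑< (suc (suc N)) g                    ≡⟨ ∑<-snoc (suc N) g ⟩
    ∑< (suc N) g + g (suc N)              ≡⟨ cong (∑< (suc N) g +_) last-term ⟩
    ∑< (suc N) g + surjections (suc N) k  ≡⟨ ℕP.+-comm (∑< (suc N) g) _ ⟩
    surjections (suc N) k + ∑< (suc N) g  ≡⟨ cong (surjections (suc N) k +_) hockey-stick ⟩
    surjections (suc N) k + ∑< a (λ y → binomialSurjections N y k) ∎
    where
    open ≡-Reasoning
    g = λ b → surjections b k * (a C (suc N ∸ b))
    last-term : g (suc N) ≡ surjections (suc N) k
    last-term rewrite ℕP.n∸n≡0 N = ℕP.*-identityʳ (surjections (suc N) k)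
    hockey-stick : ∑< (suc N) g ≡ ∑< a (λ y → binomialSurjections N y k)
    hockey-stick = begin
      ∑< (suc N) g
        ≡⟨ ∑<-cong (suc N) (λ b b≤N → cong (λ t → surjections b k * (a C t))
                                           (ℕP.+-∸-assoc 1 (ℕP.≤-pred b≤N))) ⟩
      ∑< (suc N) (λ b → surjections b k * (a C suc (N ∸ b)))
        ≡⟨ ∑<-cong (suc N) (λ b _ → cong (surjections b k *_) (sym (∑<-C a (N ∸ b)))) ⟩
      ∑< (suc N) (λ b → surjections b k * ∑< a (λ y → y C (N ∸ b)))
        ≡⟨ ∑<-cong (suc N) (λ b _ → sym (*-distribˡ-∑< a (surjections b k) (λ y → y C (N ∸ b)))) ⟩
      ∑< (suc N) (λ b → ∑< a (λ y → surjections b k * (y C (N ∸ b))))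
        ≡⟨ ∑<-comm (suc N) a (λ b y → surjections b k * (y C (N ∸ b))) ⟩
      ∑< a (λ y → binomialSurjections N y k) ∎

  ∑-binomialSurjections : ∀ N k →
    ∑< (suc N) (λ y → binomialSurjections N y k) ≡ surjections (suc N) (suc k)
  ∑-binomialSurjections N k = ℕP.+-cancelˡ-≡ (surjections (suc N) k) _ _ (begin
    surjections (suc N) k + ∑< (suc N) (λ y → binomialSurjections N y k)
      ≡⟨ sym (binomialSurjections-suc N (suc N) k) ⟩
    binomialSurjections (suc N) (suc N) k
      ≡⟨ ∑<-cong (suc (suc N)) (λ b b≤ → trans (cong (surjections b k *_) (sym (nCk≡nC[n∸k] (ℕP.≤-pred b≤))))
                                                (ℕP.*-comm (surjections b k) _)) ⟩
    ∑< (suc (suc N)) (λ b → (suc N C b) * surjections b k)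
      ≡⟨ sym (binomialSum≡∑C (suc N) (λ u → surjections u k)) ⟩
    binomialSum (suc N) (λ u → surjections u k)
      ≡⟨ binomialSum-split (suc N) (λ u → surjections u k) ⟩
    surjections (suc N) k + surjections (suc N) (suc k) ∎)
    where open ≡-Reasoning

  missing : ∀ {m} → Subset m → ℕ
  missing []          = 0
  missing (false ∷ S) = suc (missing S)
  missing (true ∷ S)  = missing S

  missing-∅ : ∀ m → missing (∅ {m}) ≡ m
  missing-∅ zero    = refl
  missing-∅ (suc m) = cong suc (missing-∅ m)

  missing≡0⇔≡⊤ : ∀ {m} (S : Subset m) → missing S ≡ 0 ⇔ S ≡ ⊤
  missing≡0⇔≡⊤ {m} S = mk⇔ (to S) (λ { refl → missing-⊤ m })
    where
    to : ∀ {m} (S : Subset m) → missing S ≡ 0 → S ≡ ⊤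
    to []         _ = refl
    to (true ∷ S) h = cong (true ∷_) (to S h)
    missing-⊤ : ∀ m → missing (⊤ {m}) ≡ 0
    missing-⊤ zero    = refl
    missing-⊤ (suc m) = missing-⊤ m

  zero∉outside∷ : ∀ {m} {S : Subset m} → zero ∉ (false ∷ S)
  zero∉outside∷ ()

  ∑-allSubsets-suc : ∀ m (g : Subset (suc m) → ℕ) →
    ∑∈ (allSubsets (suc m)) g ≡ ∑[ S ∈ allSubsets m ] g (false ∷ S) + ∑[ S ∈ allSubsets m ] g (true ∷ S)
  ∑-allSubsets-suc m g =
    trans (∑∈-allVecs-suc _ m g) (cong (∑[ S ∈ allSubsets m ] g (false ∷ S) +_) (ℕP.+-identityʳ _))

  ∑-supersets : ∀ m (S : Subset m) (f : ℕ → ℕ) →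
    ∑[ S′ ∈ allSubsets m ] (𝟙 (S ⊆? S′) * f (missing S′)) ≡ binomialSum (missing S) f
  ∑-supersets zero    []          f rewrite 𝟙-yes ([] ⊆? []) (λ x → x) =
    trans (ℕP.+-identityʳ _) (ℕP.+-identityʳ (f 0))
  ∑-supersets (suc m) (false ∷ S) f = begin
    _ ≡⟨ ∑-allSubsets-suc m _ ⟩
    ∑[ S′ ∈ Ss ] (𝟙 ((false ∷ S) ⊆? (false ∷ S′)) * f (suc (missing S′))) +
    ∑[ S′ ∈ Ss ] (𝟙 ((false ∷ S) ⊆? (true ∷ S′)) * f (missing S′))
      ≡⟨ cong₂ _+_
           (∑∈-cong Ss (λ S′ → cong (_* f (suc (missing S′)))
              (𝟙-⇔ ((false ∷ S) ⊆? (false ∷ S′)) (S ⊆? S′) (Equiv.sym out⊆-⇔))))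
           (∑∈-cong Ss (λ S′ → cong (_* f (missing S′))
              (𝟙-⇔ ((false ∷ S) ⊆? (true ∷ S′)) (S ⊆? S′) (Equiv.sym out⊆-⇔)))) ⟩
    ∑[ S′ ∈ Ss ] (𝟙 (S ⊆? S′) * f (suc (missing S′))) + ∑[ S′ ∈ Ss ] (𝟙 (S ⊆? S′) * f (missing S′))
      ≡⟨ cong₂ _+_ (∑-supersets m S (f ∘ suc)) (∑-supersets m S f) ⟩
    binomialSum (missing (false ∷ S)) f ∎
    where
    open ≡-Reasoning
    Ss = allSubsets m
  ∑-supersets (suc m) (true ∷ S)  f = begin
    _ ≡⟨ ∑-allSubsets-suc m _ ⟩
    ∑[ S′ ∈ Ss ] (𝟙 ((true ∷ S) ⊆? (false ∷ S′)) * f (suc (missing S′))) +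
    ∑[ S′ ∈ Ss ] (𝟙 ((true ∷ S) ⊆? (true ∷ S′)) * f (missing S′))
      ≡⟨ cong₂ _+_
           (∑∈-zero Ss _ (λ S′ → cong (_* f (suc (missing S′)))
              (𝟙-no ((true ∷ S) ⊆? (false ∷ S′)) (λ S⊆S′ → zero∉outside∷ (S⊆S′ here)))))
           (∑∈-cong Ss (λ S′ → cong (_* f (missing S′))
              (𝟙-⇔ ((true ∷ S) ⊆? (true ∷ S′)) (S ⊆? S′) (Equiv.sym in⊆in-⇔)))) ⟩
    0 + ∑[ S′ ∈ Ss ] (𝟙 (S ⊆? S′) * f (missing S′))
      ≡⟨ cong (0 +_) (∑-supersets m S f) ⟩
    binomialSum (missing (true ∷ S)) f ∎
    where
    open ≡-Reasoning
    Ss = allSubsets m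

  ∑-properSupersets : ∀ m (S : Subset m) (f : ℕ → ℕ) →
    ∑[ S′ ∈ allSubsets m ] (𝟙 (S ⊂? S′) * f (missing S′)) ≡ properBinomialSum (missing S) f
  ∑-properSupersets zero    []          f rewrite 𝟙-no ([] ⊂? []) (λ { (_ , () , _) }) = refl
  ∑-properSupersets (suc m) (false ∷ S) f = begin
    _ ≡⟨ ∑-allSubsets-suc m _ ⟩
    ∑[ S′ ∈ Ss ] (𝟙 ((false ∷ S) ⊂? (false ∷ S′)) * f (suc (missing S′))) +
    ∑[ S′ ∈ Ss ] (𝟙 ((false ∷ S) ⊂? (true ∷ S′)) * f (missing S′))
      ≡⟨ cong₂ _+_
           (∑∈-cong Ss (λ S′ → cong (_* f (suc (missing S′)))
              (𝟙-⇔ ((false ∷ S) ⊂? (false ∷ S′)) (S ⊂? S′) (Equiv.sym out⊂out-⇔))))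
           (∑∈-cong Ss (λ S′ → cong (_* f (missing S′))
              (𝟙-⇔ ((false ∷ S) ⊂? (true ∷ S′)) (S ⊆? S′) (Equiv.sym out⊂in-⇔)))) ⟩
    ∑[ S′ ∈ Ss ] (𝟙 (S ⊂? S′) * f (suc (missing S′))) + ∑[ S′ ∈ Ss ] (𝟙 (S ⊆? S′) * f (missing S′))
      ≡⟨ cong₂ _+_ (∑-properSupersets m S (f ∘ suc)) (∑-supersets m S f) ⟩
    properBinomialSum (missing (false ∷ S)) f ∎
    where
    open ≡-Reasoning
    Ss = allSubsets m
  ∑-properSupersets (suc m) (true ∷ S)  f = begin
    _ ≡⟨ ∑-allSubsets-suc m _ ⟩
    ∑[ S′ ∈ Ss ] (𝟙 ((true ∷ S) ⊂? (false ∷ S′)) * f (suc (missing S′))) +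
    ∑[ S′ ∈ Ss ] (𝟙 ((true ∷ S) ⊂? (true ∷ S′)) * f (missing S′))
      ≡⟨ cong₂ _+_
           (∑∈-zero Ss _ (λ S′ → cong (_* f (suc (missing S′)))
              (𝟙-no ((true ∷ S) ⊂? (false ∷ S′)) (λ S⊂S′ → zero∉outside∷ (proj₁ S⊂S′ here)))))
           (∑∈-cong Ss (λ S′ → cong (_* f (missing S′))
              (𝟙-⇔ ((true ∷ S) ⊂? (true ∷ S′)) (S ⊂? S′) (Equiv.sym in⊂in-⇔)))) ⟩
    0 + ∑[ S′ ∈ Ss ] (𝟙 (S ⊂? S′) * f (missing S′))
      ≡⟨ cong (0 +_) (∑-properSupersets m S f) ⟩
    properBinomialSum (missing (true ∷ S)) f ∎
    where
    open ≡-Reasoning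
    Ss = allSubsets m

  _≟ˢ_ : ∀ {m} → (S S′ : Subset m) → Dec (S ≡ S′)
  _≟ˢ_ = VecP.≡-dec BoolP._≟_

  ChainAbove : ∀ {m} i → Subset m → Vec (Subset m) (suc i) → Set
  ChainAbove zero    S (S₀ ∷ []) = S ⊂ S₀ × S₀ ≡ ⊤
  ChainAbove (suc i) S (S₀ ∷ c)  = S ⊂ S₀ × ChainAbove i S₀ c

  chainAbove? : ∀ {m} i (S : Subset m) → Decidable (ChainAbove i S)
  chainAbove? zero    S (S₀ ∷ []) = (S ⊂? S₀) ×-dec (S₀ ≟ˢ ⊤)
  chainAbove? (suc i) S (S₀ ∷ c)  = (S ⊂? S₀) ×-dec chainAbove? i S₀ c

  #chainsAbove : ∀ m i (S : Subset m) →
    ∑[ c ∈ allVecs (allSubsets m) (suc i) ] 𝟙 (chainAbove? i S c) ≡ surjections (missing S) (suc i)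
  #chainsAbove m zero S = begin
    _ ≡⟨ ∑∈-allVecs-suc (allSubsets m) 0 _ ⟩
    ∑[ S₀ ∈ allSubsets m ] (𝟙 (chainAbove? zero S (S₀ ∷ [])) + 0)
      ≡⟨ ∑∈-cong (allSubsets m) (λ S₀ → trans (ℕP.+-identityʳ _)
           (trans (𝟙-×-dec (S ⊂? S₀) (S₀ ≟ˢ ⊤)) (cong (𝟙 (S ⊂? S₀) *_) (top S₀)))) ⟩
    ∑[ S₀ ∈ allSubsets m ] (𝟙 (S ⊂? S₀) * surjections (missing S₀) 0)
      ≡⟨ ∑-properSupersets m S (λ u → surjections u 0) ⟩
    surjections (missing S) 1 ∎
    where
    open ≡-Reasoning
    top : ∀ S₀ → 𝟙 (S₀ ≟ˢ ⊤) ≡ surjections (missing S₀) 0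
    top S₀ = trans (𝟙-⇔ (S₀ ≟ˢ ⊤) (missing S₀ ℕ.≟ 0) (Equiv.sym (missing≡0⇔≡⊤ S₀)))
                   (sym (surjections-zero (missing S₀)))
  #chainsAbove m (suc i) S = begin
    _ ≡⟨ ∑∈-allVecs-suc (allSubsets m) (suc i) _ ⟩
    ∑[ S₀ ∈ allSubsets m ] ∑[ c ∈ Cs ] 𝟙 (chainAbove? (suc i) S (S₀ ∷ c))
      ≡⟨ ∑∈-cong (allSubsets m) (λ S₀ → trans (∑∈-cong Cs (λ c → 𝟙-×-dec (S ⊂? S₀) (chainAbove? i S₀ c)))
                                               (*-distribˡ-∑∈ Cs (𝟙 (S ⊂? S₀)) _)) ⟩
    ∑[ S₀ ∈ allSubsets m ] (𝟙 (S ⊂? S₀) * ∑[ c ∈ Cs ] 𝟙 (chainAbove? i S₀ c))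
      ≡⟨ ∑∈-cong (allSubsets m) (λ S₀ → cong (𝟙 (S ⊂? S₀) *_) (#chainsAbove m i S₀)) ⟩
    ∑[ S₀ ∈ allSubsets m ] (𝟙 (S ⊂? S₀) * surjections (missing S₀) (suc i))
      ≡⟨ ∑-properSupersets m S (λ u → surjections u (suc i)) ⟩
    surjections (missing S) (suc (suc i)) ∎
    where
    open ≡-Reasoning
    Cs = allVecs (allSubsets m) (suc i)

  IsChain⇔ChainAbove∅ : ∀ {m} i (c : Vec (Subset m) (suc i)) → IsChain c ⇔ ChainAbove i ∅ c
  IsChain⇔ChainAbove∅ i c = mk⇔ (λ c-chain → to i ∅ c (∅⊂ (proj₁ c-chain zero)) c-chain)
                                 (λ c-above → proj₂ (from i ∅ c c-above))
    where
    ∅⊂ : ∀ {m} {S : Subset m} → Nonempty S → ∅ ⊂ S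
    ∅⊂ (x , x∈S) = ⊥⊆ , x , x∈S , ∉⊥
    nonempty : ∀ {m} {S S′ : Subset m} → S ⊂ S′ → Nonempty S′
    nonempty (_ , x , x∈S′ , _) = x , x∈S′
    to : ∀ {m} i (S : Subset m) c → S ⊂ lookup c zero → IsChain c → ChainAbove i S c
    to zero    S (S₀ ∷ []) S⊂S₀ (_ , _ , top)     = S⊂S₀ , top
    to (suc i) S (S₀ ∷ c)  S⊂S₀ (ne , inc , top) =
      S⊂S₀ , to i S₀ c (inc zero) ((ne ∘ suc) , (inc ∘ suc) , top)
    from : ∀ {m} i (S : Subset m) c → ChainAbove i S c → S ⊂ lookup c zero × IsChain c
    from zero    S (S₀ ∷ []) (S⊂S₀ , top) = S⊂S₀ , (λ { zero → nonempty S⊂S₀ }) , (λ ()) , top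
    from (suc i) S (S₀ ∷ c)  (S⊂S₀ , above) with from i S₀ c above
    ... | S₀⊂ , ne , inc , top =
      S⊂S₀ , (λ { zero → nonempty S⊂S₀ ; (suc k) → ne k }) , (λ { zero → S₀⊂ ; (suc k) → inc k }) , top

  chains≡surjections : ∀ i m → chains i m ≡ surjections m (suc i)
  chains≡surjections i m = begin
    chains i m
      ≡⟨ count≡∑𝟙 isChain? Cs ⟩
    ∑[ c ∈ Cs ] 𝟙 (isChain? c)
      ≡⟨ ∑∈-cong Cs (λ c → 𝟙-⇔ (isChain? c) (chainAbove? i ∅ c) (IsChain⇔ChainAbove∅ i c)) ⟩
    ∑[ c ∈ Cs ] 𝟙 (chainAbove? i ∅ c)
      ≡⟨ #chainsAbove m i ∅ ⟩
    surjections (missing (∅ {m})) (suc i)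
      ≡⟨ cong (λ r → surjections r (suc i)) (missing-∅ m) ⟩
    surjections m (suc i) ∎
    where
    open ≡-Reasoning
    Cs = allVecs (allSubsets m) (suc i)

  descents : ∀ {K m} → Vec (Fin K) (suc m) → ℕ
  descents {m = m} v = count (λ k → lookup v (suc k) Fin.<? lookup v (inject₁ k)) (allFin m)

  descents≡∑ : ∀ {K m} (v : Vec (Fin K) (suc m)) →
               descents v ≡ sum (λ k → 𝟙 (lookup v (suc k) Fin.<? lookup v (inject₁ k)))
  descents≡∑ {m = m} v = trans (count≡∑𝟙 _ (allFin m)) (∑∈-allFin m _)

  descents-∷ : ∀ {K m} (a b : Fin K) (r : Vec (Fin K) m) →
               descents (a ∷ b ∷ r) ≡ 𝟙 (b Fin.<? a) + descents (b ∷ r)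
  descents-∷ a b r =
    trans (descents≡∑ (a ∷ b ∷ r)) (cong (𝟙 (b Fin.<? a) +_) (sym (descents≡∑ (b ∷ r))))

  descents≤ : ∀ {K m} (v : Vec (Fin K) (suc m)) → descents v ≤ m
  descents≤ {m = zero}  (a ∷ [])    = z≤n
  descents≤ {m = suc m} (a ∷ b ∷ r) rewrite descents-∷ a b r =
    ℕP.+-mono-≤ (𝟙≤1 (b Fin.<? a)) (descents≤ (b ∷ r))

  punchIn-<-⇔ : ∀ {m} (x : Fin (suc m)) (a b : Fin m) → punchIn x a Fin.< punchIn x b ⇔ a Fin.< b
  punchIn-<-⇔ x a b = mk⇔
    (λ pa<pb → ℕP.≰⇒> (λ b≤a → ℕP.<⇒≱ pa<pb (FinP.punchIn-mono-≤ x b a b≤a)))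
    (λ a<b → ℕP.≰⇒> (λ pb≤pa → ℕP.<⇒≱ a<b (FinP.punchIn-cancel-≤ x b a pb≤pa)))

  punchIn<⇔< : ∀ {m} (x : Fin (suc m)) (y : Fin m) → punchIn x y Fin.< x ⇔ toℕ y < toℕ x
  punchIn<⇔< x y = mk⇔ (to x y) (from x y)
    where
    to : ∀ {m} (x : Fin (suc m)) (y : Fin m) → punchIn x y Fin.< x → toℕ y < toℕ x
    to (suc x) zero    _         = s≤s z≤n
    to (suc x) (suc y) (s≤s p<x) = s≤s (to x y p<x)
    from : ∀ {m} (x : Fin (suc m)) (y : Fin m) → toℕ y < toℕ x → punchIn x y Fin.< x
    from (suc x) zero    _         = s≤s z≤n
    from (suc x) (suc y) (s≤s y<x) = s≤s (from x y y<x)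

  descents-punchIn : ∀ {K m} (x : Fin (suc K)) (v : Vec (Fin K) (suc m)) →
                     descents (Vec.map (punchIn x) v) ≡ descents v
  descents-punchIn {m = zero}  x (a ∷ [])    = refl
  descents-punchIn {m = suc m} x (a ∷ b ∷ r) = begin
    descents (punchIn x a ∷ punchIn x b ∷ Vec.map (punchIn x) r)
      ≡⟨ descents-∷ (punchIn x a) (punchIn x b) (Vec.map (punchIn x) r) ⟩
    𝟙 (punchIn x b Fin.<? punchIn x a) + descents (Vec.map (punchIn x) (b ∷ r))
      ≡⟨ cong₂ _+_ (𝟙-⇔ (punchIn x b Fin.<? punchIn x a) (b Fin.<? a) (punchIn-<-⇔ x b a))
                   (descents-punchIn x (b ∷ r)) ⟩
    𝟙 (b Fin.<? a) + descents (b ∷ r)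
      ≡⟨ sym (descents-∷ a b r) ⟩
    descents (a ∷ b ∷ r) ∎
    where open ≡-Reasoning

  IsPerm-punchIn-⇔ : ∀ {m} (x : Fin (suc m)) (w : Vec (Fin m) m) →
                     IsPerm (x ∷ Vec.map (punchIn x) w) ⇔ IsPerm w
  IsPerm-punchIn-⇔ x w = mk⇔ to from
    where
    pI = punchIn x
    lookup-pI : ∀ k → lookup (Vec.map pI w) k ≡ pI (lookup w k)
    lookup-pI k = VecP.lookup-map k pI w
    to : IsPerm (x ∷ Vec.map pI w) → IsPerm w
    to (inj , surj) = inj′ , surj′
      where
      inj′ : ∀ a b → lookup w a ≡ lookup w b → a ≡ b
      inj′ a b e = FinP.suc-injective
        (inj (suc a) (suc b) (trans (lookup-pI a) (trans (cong pI e) (sym (lookup-pI b)))))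
      surj′ : ∀ y → ∃ λ k → lookup w k ≡ y
      surj′ y with surj (pI y)
      ... | zero  , e = contradiction (sym e) (FinP.punchInᵢ≢i x y)
      ... | suc k , e = k , FinP.punchIn-injective x _ _ (trans (sym (lookup-pI k)) e)
    from : IsPerm w → IsPerm (x ∷ Vec.map pI w)
    from (inj , surj) = inj′ , surj′
      where
      inj′ : ∀ a b → lookup (x ∷ Vec.map pI w) a ≡ lookup (x ∷ Vec.map pI w) b → a ≡ b
      inj′ zero    zero    e = refl
      inj′ zero    (suc b) e = contradiction (sym (trans e (lookup-pI b))) (FinP.punchInᵢ≢i x (lookup w b))
      inj′ (suc a) zero    e = contradiction (trans (sym (lookup-pI a)) e) (FinP.punchInᵢ≢i x (lookup w a))
      inj′ (suc a) (suc b) e =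
        cong suc (inj a b (FinP.punchIn-injective x _ _ (trans (sym (lookup-pI a)) (trans e (lookup-pI b)))))
      surj′ : ∀ y → ∃ λ k → lookup (x ∷ Vec.map pI w) k ≡ y
      surj′ y with y Fin.≟ x
      ... | yes refl = zero , refl
      ... | no y≢x with surj (punchOut (y≢x ∘ sym))
      ...   | k , e = suc k , trans (lookup-pI k) (trans (cong pI e) (FinP.punchIn-punchOut (y≢x ∘ sym)))

  words : ∀ K L → List (Vec (Fin K) L)
  words K L = allVecs (allFin K) L

  𝟙∉ : ∀ {K L} → Fin K → Vec (Fin K) L → ℕ
  𝟙∉ x []      = 1
  𝟙∉ x (y ∷ w) = 𝟙 (¬? (y Fin.≟ x)) * 𝟙∉ x w

  𝟙∉≡1 : ∀ {K L} (x : Fin K) (w : Vec (Fin K) L) → (∀ k → lookup w k ≢ x) → 𝟙∉ x w ≡ 1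
  𝟙∉≡1 x []      _      = refl
  𝟙∉≡1 x (y ∷ w) x∉y∷w rewrite 𝟙-yes (¬? (y Fin.≟ x)) (x∉y∷w zero) =
    trans (ℕP.+-identityʳ _) (𝟙∉≡1 x w (x∉y∷w ∘ suc))

  ∑-≢-punchIn : ∀ {m} (x : Fin (suc m)) (h : Fin (suc m) → ℕ) →
                sum (λ y → 𝟙 (¬? (y Fin.≟ x)) * h y) ≡ sum (h ∘ punchIn x)
  ∑-≢-punchIn x h = begin
    sum g                            ≡⟨ sum-remove {i = x} g ⟩
    g x + sum (g ∘ punchIn x)        ≡⟨ cong₂ _+_ (cong (_* h x) (𝟙-no (¬? (x Fin.≟ x)) (λ x≢x → x≢x refl)))
                                                  (sum-cong-≋ (λ y → cong (_* h (punchIn x y)) (≢x y))) ⟩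
    sum (λ y → 1 * h (punchIn x y))  ≡⟨ sum-cong-≋ (λ y → ℕP.*-identityˡ (h (punchIn x y))) ⟩
    sum (h ∘ punchIn x)              ∎
    where
    open ≡-Reasoning
    g = λ y → 𝟙 (¬? (y Fin.≟ x)) * h y
    ≢x : ∀ y → 𝟙 (¬? (punchIn x y Fin.≟ x)) ≡ 1
    ≢x y = 𝟙-yes (¬? (punchIn x y Fin.≟ x)) (FinP.punchInᵢ≢i x y)

  ∑-avoiding : ∀ m L (x : Fin (suc m)) (g : Vec (Fin (suc m)) L → ℕ) →
    ∑[ w ∈ words (suc m) L ] (𝟙∉ x w * g w) ≡ ∑[ w ∈ words m L ] g (Vec.map (punchIn x) w)
  ∑-avoiding m zero    x g = cong (_+ 0) (ℕP.*-identityˡ (g []))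
  ∑-avoiding m (suc L) x g = begin
    ∑[ w ∈ words (suc m) (suc L) ] (𝟙∉ x w * g w)
      ≡⟨ ∑∈-allVecs-suc (allFin (suc m)) L _ ⟩
    ∑[ y ∈ allFin (suc m) ] ∑[ w ∈ Ws ] (𝟙 (y≢x y) * 𝟙∉ x w * g (y ∷ w))
      ≡⟨ ∑∈-allFin (suc m) _ ⟩
    sum (λ y → ∑[ w ∈ Ws ] (𝟙 (y≢x y) * 𝟙∉ x w * g (y ∷ w)))
      ≡⟨ sum-cong-≋ (λ y → trans (∑∈-cong Ws (λ w → ℕP.*-assoc (𝟙 (y≢x y)) (𝟙∉ x w) (g (y ∷ w))))
                                  (*-distribˡ-∑∈ Ws (𝟙 (y≢x y)) _)) ⟩
    sum (λ y → 𝟙 (y≢x y) * ∑[ w ∈ Ws ] (𝟙∉ x w * g (y ∷ w)))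
      ≡⟨ sum-cong-≋ (λ y → cong (𝟙 (y≢x y) *_) (∑-avoiding m L x (g ∘ (y ∷_)))) ⟩
    sum (λ y → 𝟙 (y≢x y) * ∑[ w ∈ words m L ] g (y ∷ Vec.map (punchIn x) w))
      ≡⟨ ∑-≢-punchIn x (λ y → ∑[ w ∈ words m L ] g (y ∷ Vec.map (punchIn x) w)) ⟩
    sum (λ y → ∑[ w ∈ words m L ] g (punchIn x y ∷ Vec.map (punchIn x) w))
      ≡⟨ sym (∑∈-allFin m _) ⟩
    ∑[ y ∈ allFin m ] ∑[ w ∈ words m L ] g (Vec.map (punchIn x) (y ∷ w))
      ≡⟨ sym (∑∈-allVecs-suc (allFin m) L _) ⟩
    ∑[ w ∈ words m (suc L) ] g (Vec.map (punchIn x) w) ∎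
    where
    open ≡-Reasoning
    Ws = words (suc m) L
    y≢x = λ y → ¬? (y Fin.≟ x)

  𝟙-permWith : ∀ m i j (v : Vec (Fin (suc m)) (suc m)) →
    𝟙 (permWith? m i j v) ≡ 𝟙 (suc (toℕ (lookup v zero)) ℕ.≟ j) * (𝟙 (isPerm? v) * 𝟙 (des v ℕ.≟ i))
  𝟙-permWith m i j v = begin
    𝟙 (isPerm? v ×-dec (first? ×-dec des?))  ≡⟨ 𝟙-×-dec (isPerm? v) (first? ×-dec des?) ⟩
    𝟙 (isPerm? v) * 𝟙 (first? ×-dec des?)   ≡⟨ cong (𝟙 (isPerm? v) *_) (𝟙-×-dec first? des?) ⟩
    𝟙 (isPerm? v) * (𝟙 first? * 𝟙 des?)     ≡⟨ *-x∙yz≈y∙xz (𝟙 (isPerm? v)) (𝟙 first?) (𝟙 des?) ⟩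
    𝟙 first? * (𝟙 (isPerm? v) * 𝟙 des?)     ∎
    where
    open ≡-Reasoning
    first? = suc (toℕ (lookup v zero)) ℕ.≟ j
    des?   = des v ℕ.≟ i

  A′ : ℕ → ℕ → ℕ → ℕ
  A′ N i y = A (suc N) i (suc y)

  A′⁻ : ℕ → ℕ → ℕ → ℕ
  A′⁻ N zero    y = 0
  A′⁻ N (suc i) y = A′ N i y

  A′-top : ∀ N y → A′ N (suc N) y ≡ 0
  A′-top N y = count-none (permWith? N (suc N) (suc y)) (words (suc N) (suc N))
    (λ w (_ , _ , des≡) → ℕP.<⇒≱ (ℕP.n<1+n N) (subst (_≤ N) des≡ (descents≤ w)))

  A′-as-sum : ∀ N i y → A′ N i y ≡
    ∑[ w ∈ words (suc N) (suc N) ] (𝟙 (toℕ (lookup w zero) ℕ.≟ y) * (𝟙 (isPerm? w) * 𝟙 (des w ℕ.≟ i)))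
  A′-as-sum N i y = trans (count≡∑𝟙 (permWith? N i (suc y)) (words (suc N) (suc N)))
    (∑∈-cong (words (suc N) (suc N)) (λ w → trans (𝟙-permWith N i (suc y) w)
      (cong (_* _) (𝟙-⇔ (suc (toℕ (lookup w zero)) ℕ.≟ suc y) (toℕ (lookup w zero) ℕ.≟ y)
                         (mk⇔ ℕP.suc-injective (cong suc))))))

  A≡∑-tails : ∀ m i (x : Fin (suc m)) →
    A (suc m) i (suc (toℕ x)) ≡ ∑[ w ∈ words (suc m) m ] (𝟙 (isPerm? (x ∷ w)) * 𝟙 (des (x ∷ w) ℕ.≟ i))
  A≡∑-tails m i x = begin
    A (suc m) i j
      ≡⟨ count≡∑𝟙 (permWith? m i j) (words (suc m) (suc m)) ⟩
    ∑[ v ∈ words (suc m) (suc m) ] 𝟙 (permWith? m i j v)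
      ≡⟨ ∑∈-allVecs-suc (allFin (suc m)) m (𝟙 ∘ permWith? m i j) ⟩
    ∑[ x′ ∈ allFin (suc m) ] ∑[ w ∈ Ws ] 𝟙 (permWith? m i j (x′ ∷ w))
      ≡⟨ ∑∈-allFin (suc m) (λ x′ → ∑[ w ∈ Ws ] 𝟙 (permWith? m i j (x′ ∷ w))) ⟩
    sum (λ x′ → ∑[ w ∈ Ws ] 𝟙 (permWith? m i j (x′ ∷ w)))
      ≡⟨ sum-cong-≋ (λ x′ → trans (∑∈-cong Ws (λ w → 𝟙-permWith m i j (x′ ∷ w)))
                                   (*-distribˡ-∑∈ Ws (𝟙 (suc (toℕ x′) ℕ.≟ j)) (G x′))) ⟩
    sum (λ x′ → 𝟙 (suc (toℕ x′) ℕ.≟ j) * ∑[ w ∈ Ws ] G x′ w)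
      ≡⟨ sum-pick x (λ x′ → 𝟙 (suc (toℕ x′) ℕ.≟ j)) (λ x′ → ∑[ w ∈ Ws ] G x′ w) (𝟙-yes (j ℕ.≟ j) refl)
           (λ x′ x′≢x → 𝟙-no (suc (toℕ x′) ℕ.≟ j) (x′≢x ∘ FinP.toℕ-injective ∘ ℕP.suc-injective)) ⟩
    ∑[ w ∈ Ws ] G x w ∎
    where
    open ≡-Reasoning
    j = suc (toℕ x)
    Ws = words (suc m) m
    G = λ x′ w → 𝟙 (isPerm? (x′ ∷ w)) * 𝟙 (des (x′ ∷ w) ℕ.≟ i)

  ∑-tails≡∑-standardized : ∀ N i (x : Fin (suc (suc N))) →
    ∑[ w ∈ words (suc (suc N)) (suc N) ] (𝟙 (isPerm? (x ∷ w)) * 𝟙 (des (x ∷ w) ℕ.≟ i))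
    ≡ ∑[ w ∈ words (suc N) (suc N) ] (𝟙 (isPerm? w) * 𝟙 (𝟙 (toℕ (lookup w zero) ℕ.<? toℕ x) + des w ℕ.≟ i))
  ∑-tails≡∑-standardized N i x = begin
    ∑[ w ∈ words (suc (suc N)) (suc N) ] G w
      ≡⟨ ∑∈-cong (words (suc (suc N)) (suc N)) tail-avoids-x ⟩
    ∑[ w ∈ words (suc (suc N)) (suc N) ] (𝟙∉ x w * G w)
      ≡⟨ ∑-avoiding (suc N) (suc N) x G ⟩
    ∑[ w ∈ words (suc N) (suc N) ] G (Vec.map (punchIn x) w)
      ≡⟨ ∑∈-cong (words (suc N) (suc N)) standardize ⟩
    _ ∎
    where
    open ≡-Reasoning
    G = λ w → 𝟙 (isPerm? (x ∷ w)) * 𝟙 (des (x ∷ w) ℕ.≟ i)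
    tail-avoids-x : ∀ w → G w ≡ 𝟙∉ x w * G w
    tail-avoids-x w with isPerm? (x ∷ w)
    ... | yes (inj , _) = sym (trans
      (cong (_* (1 * 𝟙 (des (x ∷ w) ℕ.≟ i))) (𝟙∉≡1 x w (λ k wₖ≡x → FinP.0≢1+n (sym (inj (suc k) zero wₖ≡x)))))
      (ℕP.*-identityˡ _))
    ... | no _ = sym (ℕP.*-zeroʳ (𝟙∉ x w))
    standardize : ∀ w → G (Vec.map (punchIn x) w) ≡
                        𝟙 (isPerm? w) * 𝟙 (𝟙 (toℕ (lookup w zero) ℕ.<? toℕ x) + des w ℕ.≟ i)
    standardize (a ∷ r) = cong₂ _*_
      (𝟙-⇔ (isPerm? (x ∷ Vec.map (punchIn x) (a ∷ r))) (isPerm? (a ∷ r)) (IsPerm-punchIn-⇔ x (a ∷ r)))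
      (cong (λ n → 𝟙 (n ℕ.≟ i)) (trans (descents-∷ x (punchIn x a) (Vec.map (punchIn x) r))
        (cong₂ _+_ (𝟙-⇔ (punchIn x a Fin.<? x) (toℕ a ℕ.<? toℕ x) (punchIn<⇔< x a))
                   (descents-punchIn x (a ∷ r)))))

  ∑-perms-offset : ∀ N i y (P? : Dec P) →
    ∑[ w ∈ words (suc N) (suc N) ] (𝟙 (toℕ (lookup w zero) ℕ.≟ y) * (𝟙 (isPerm? w) * 𝟙 (𝟙 P? + des w ℕ.≟ i)))
    ≡ (if does P? then A′⁻ N i y else A′ N i y)
  ∑-perms-offset N i       y (no _)  = sym (A′-as-sum N i y)
  ∑-perms-offset N zero    y (yes _) = ∑∈-zero (words (suc N) (suc N)) _ (λ w →
    trans (cong (λ t → 𝟙 (toℕ (lookup w zero) ℕ.≟ y) * (𝟙 (isPerm? w) * t)) (𝟙-no (suc (des w) ℕ.≟ 0) (λ ())))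
          (trans (cong (𝟙 (toℕ (lookup w zero) ℕ.≟ y) *_) (ℕP.*-zeroʳ (𝟙 (isPerm? w))))
                 (ℕP.*-zeroʳ (𝟙 (toℕ (lookup w zero) ℕ.≟ y)))))
  ∑-perms-offset N (suc i) y (yes _) = trans
    (∑∈-cong (words (suc N) (suc N)) (λ w → cong (λ t → 𝟙 (toℕ (lookup w zero) ℕ.≟ y) * (𝟙 (isPerm? w) * t))
      (𝟙-⇔ (suc (des w) ℕ.≟ suc i) (des w ℕ.≟ i) (mk⇔ ℕP.suc-injective (cong suc)))))
    (sym (A′-as-sum N i y))

  ∑-standardized≡ : ∀ N i x →
    ∑[ w ∈ words (suc N) (suc N) ] (𝟙 (isPerm? w) * 𝟙 (𝟙 (toℕ (lookup w zero) ℕ.<? x) + des w ℕ.≟ i))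
    ≡ ∑< (suc N) (λ y → if does (y ℕ.<? x) then A′⁻ N i y else A′ N i y)
  ∑-standardized≡ N i x = begin
    ∑[ w ∈ Ws ] Q′ (toℕ (lookup w zero)) w
      ≡⟨ ∑∈-cong Ws (λ w → sym (sum-pick (lookup w zero) (λ k → 𝟙 (toℕ (lookup w zero) ℕ.≟ toℕ k))
                                          (λ k → Q′ (toℕ k) w) (𝟙-yes (_ ℕ.≟ _) refl)
                                          (λ k k≢w₀ → 𝟙-no (_ ℕ.≟ _) (k≢w₀ ∘ sym ∘ FinP.toℕ-injective)))) ⟩
    ∑[ w ∈ Ws ] ∑< (suc N) (λ y → 𝟙 (toℕ (lookup w zero) ℕ.≟ y) * Q′ y w)
      ≡⟨ ∑∈-∑<-comm Ws (suc N) (λ y w → 𝟙 (toℕ (lookup w zero) ℕ.≟ y) * Q′ y w) ⟩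
    ∑< (suc N) (λ y → ∑[ w ∈ Ws ] (𝟙 (toℕ (lookup w zero) ℕ.≟ y) * Q′ y w))
      ≡⟨ ∑<-cong (suc N) (λ y _ → ∑-perms-offset N i y (y ℕ.<? x)) ⟩
    ∑< (suc N) (λ y → if does (y ℕ.<? x) then A′⁻ N i y else A′ N i y) ∎
    where
    open ≡-Reasoning
    Ws = words (suc N) (suc N)
    Q′ = λ y w → 𝟙 (isPerm? w) * 𝟙 (𝟙 (y ℕ.<? x) + des w ℕ.≟ i)

  A′-suc : ∀ N i a → a ≤ suc N →
    A′ (suc N) i a ≡ ∑< (suc N) (λ y → if does (y ℕ.<? a) then A′⁻ N i y else A′ N i y)
  A′-suc N i a a≤ =
    subst (λ t → A′ (suc N) i t ≡ ∑< (suc N) (λ y → if does (y ℕ.<? t) then A′⁻ N i y else A′ N i y))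
          (FinP.toℕ-fromℕ< (s≤s a≤))
          (trans (A≡∑-tails (suc N) i x) (trans (∑-tails≡∑-standardized N i x) (∑-standardized≡ N i (toℕ x))))
    where
    x = fromℕ< (s≤s a≤)

  -- Entry (k, a) of T_d⁻¹ H_d is binomialDescents (d + 1) a (d + 1 − k).
  binomialDescents : ℕ → ℕ → ℕ → ℕ
  binomialDescents N a m = ∑< (suc N) (λ i → (i C m) * A′ N i a)

  binomialDescents⁻ : ℕ → ℕ → ℕ → ℕ
  binomialDescents⁻ N a zero    = 0
  binomialDescents⁻ N a (suc m) = binomialDescents N a m

  binomialDescents-top : ∀ N y → binomialDescents N y (suc N) ≡ 0
  binomialDescents-top N y = ∑<-zero (suc N) _ (λ i i≤N → cong (_* A′ N i y) (k>n⇒nCk≡0 i≤N))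

  ∑C*A′ : ∀ N y m → ∑< (suc (suc N)) (λ i → (i C m) * A′ N i y) ≡ binomialDescents N y m
  ∑C*A′ N y m = begin
    ∑< (suc (suc N)) (λ i → (i C m) * A′ N i y)
      ≡⟨ ∑<-snoc (suc N) (λ i → (i C m) * A′ N i y) ⟩
    binomialDescents N y m + (suc N C m) * A′ N (suc N) y
      ≡⟨ cong (λ t → binomialDescents N y m + (suc N C m) * t) (A′-top N y) ⟩
    binomialDescents N y m + (suc N C m) * 0
      ≡⟨ cong (binomialDescents N y m +_) (ℕP.*-zeroʳ (suc N C m)) ⟩
    binomialDescents N y m + 0
      ≡⟨ ℕP.+-identityʳ _ ⟩
    binomialDescents N y m ∎
    where open ≡-Reasoning

  ∑C*A′⁻ : ∀ N y m →
    ∑< (suc (suc N)) (λ i → (i C m) * A′⁻ N i y) ≡ binomialDescents N y m + binomialDescents⁻ N y m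
  ∑C*A′⁻ N y zero    = sym (ℕP.+-identityʳ _)
  ∑C*A′⁻ N y (suc m) = begin
    ∑< (suc N) (λ i → (suc i C suc m) * A′ N i y)
      ≡⟨ ∑<-cong (suc N) (λ i _ → cong (_* A′ N i y) (sym (nCk+nC[k+1]≡[n+1]C[k+1] i m))) ⟩
    ∑< (suc N) (λ i → ((i C m) + (i C suc m)) * A′ N i y)
      ≡⟨ ∑<-cong (suc N) (λ i _ → ℕP.*-distribʳ-+ (A′ N i y) (i C m) (i C suc m)) ⟩
    ∑< (suc N) (λ i → (i C m) * A′ N i y + (i C suc m) * A′ N i y)
      ≡⟨ ∑<-distrib-+ (suc N) (λ i → (i C m) * A′ N i y) (λ i → (i C suc m) * A′ N i y) ⟩
    binomialDescents N y m + binomialDescents N y (suc m)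
      ≡⟨ ℕP.+-comm (binomialDescents N y m) _ ⟩
    binomialDescents N y (suc m) + binomialDescents⁻ N y (suc m) ∎
    where open ≡-Reasoning

  ∑C*A′-if : ∀ N y m b →
    ∑< (suc (suc N)) (λ i → (i C m) * (if b then A′⁻ N i y else A′ N i y))
    ≡ binomialDescents N y m + (if b then binomialDescents⁻ N y m else 0)
  ∑C*A′-if N y m true  = ∑C*A′⁻ N y m
  ∑C*A′-if N y m false = trans (∑C*A′ N y m) (sym (ℕP.+-identityʳ _))

  binomialDescents-suc : ∀ N a m → a ≤ suc N →
    binomialDescents (suc N) a m
    ≡ ∑< (suc N) (λ y → binomialDescents N y m) + ∑< a (λ y → binomialDescents⁻ N y m)
  binomialDescents-suc N a m a≤ = begin
    ∑< (suc (suc N)) (λ i → (i C m) * A′ (suc N) i a)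
      ≡⟨ ∑<-cong (suc (suc N)) (λ i _ → cong ((i C m) *_) (A′-suc N i a a≤)) ⟩
    ∑< (suc (suc N)) (λ i → (i C m) * ∑< (suc N) (λ y → f i y))
      ≡⟨ ∑<-cong (suc (suc N)) (λ i _ → sym (*-distribˡ-∑< (suc N) (i C m) (f i))) ⟩
    ∑< (suc (suc N)) (λ i → ∑< (suc N) (λ y → (i C m) * f i y))
      ≡⟨ ∑<-comm (suc (suc N)) (suc N) (λ i y → (i C m) * f i y) ⟩
    ∑< (suc N) (λ y → ∑< (suc (suc N)) (λ i → (i C m) * f i y))
      ≡⟨ ∑<-cong (suc N) (λ y _ → ∑C*A′-if N y m (does (y ℕ.<? a))) ⟩
    ∑< (suc N) (λ y → binomialDescents N y m + g y)
      ≡⟨ ∑<-distrib-+ (suc N) (λ y → binomialDescents N y m) g ⟩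
    ∑< (suc N) (λ y → binomialDescents N y m) + ∑< (suc N) g
      ≡⟨ cong (∑< (suc N) (λ y → binomialDescents N y m) +_)
              (∑<-if-< (suc N) a (λ y → binomialDescents⁻ N y m) a≤) ⟩
    ∑< (suc N) (λ y → binomialDescents N y m) + ∑< a (λ y → binomialDescents⁻ N y m) ∎
    where
    open ≡-Reasoning
    f = λ i y → if does (y ℕ.<? a) then A′⁻ N i y else A′ N i y
    g = λ y → if does (y ℕ.<? a) then binomialDescents⁻ N y m else 0

  binomialDescents-step : ∀ N →
    (∀ k a → k ≤ N → a ≤ N → binomialDescents N a (N ∸ k) ≡ binomialSurjections N a k) →
    ∀ k a → k ≤ suc N → a ≤ suc N →
    binomialDescents (suc N) a (suc N ∸ k) ≡ binomialSurjections (suc N) a k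
  binomialDescents-step N IH k a k≤ a≤ =
    trans (binomialDescents-suc N a (suc N ∸ k) a≤) (by-cases k k≤)
    where
    open ≡-Reasoning
    y<a⇒y≤N : ∀ {y} → y < a → y ≤ N
    y<a⇒y≤N y<a = ℕP.≤-pred (ℕP.<-≤-trans y<a a≤)
    descents⁻≡surjections : ∀ k y → k ≤ N → y ≤ N →
                            binomialDescents⁻ N y (N ∸ k) ≡ binomialSurjections N y (suc k)
    descents⁻≡surjections k y k≤N y≤N with ℕP.m≤n⇒m<n∨m≡n k≤N
    ... | inj₁ k<N  = trans (cong (binomialDescents⁻ N y) (ℕP.+-∸-assoc 1 k<N)) (IH (suc k) y k<N y≤N)
    ... | inj₂ refl =
      trans (cong (binomialDescents⁻ N y) (ℕP.n∸n≡0 k)) (sym (binomialSurjections-top k y))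
    by-cases : ∀ k → k ≤ suc N →
      ∑< (suc N) (λ y → binomialDescents N y (suc N ∸ k)) + ∑< a (λ y → binomialDescents⁻ N y (suc N ∸ k))
      ≡ binomialSurjections (suc N) a k
    by-cases zero    _         = begin
      ∑< (suc N) (λ y → binomialDescents N y (suc N)) + ∑< a (λ y → binomialDescents N y N)
        ≡⟨ cong₂ _+_ (∑<-zero (suc N) _ (λ y _ → binomialDescents-top N y))
                     (∑<-cong a (λ y y<a → IH 0 y z≤n (y<a⇒y≤N y<a))) ⟩
      ∑< a (λ y → binomialSurjections N y 0)
        ≡⟨ sym (binomialSurjections-suc N a 0) ⟩
      binomialSurjections (suc N) a 0 ∎
    by-cases (suc k) (s≤s k≤N) = begin
      ∑< (suc N) (λ y → binomialDescents N y (N ∸ k)) + ∑< a (λ y → binomialDescents⁻ N y (N ∸ k))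
        ≡⟨ cong₂ _+_ (∑<-cong (suc N) (λ y y≤N → IH k y k≤N (ℕP.≤-pred y≤N)))
                     (∑<-cong a (λ y y<a → descents⁻≡surjections k y k≤N (y<a⇒y≤N y<a))) ⟩
      ∑< (suc N) (λ y → binomialSurjections N y k) + ∑< a (λ y → binomialSurjections N y (suc k))
        ≡⟨ cong (_+ ∑< a (λ y → binomialSurjections N y (suc k))) (∑-binomialSurjections N k) ⟩
      surjections (suc N) (suc k) + ∑< a (λ y → binomialSurjections N y (suc k))
        ≡⟨ sym (binomialSurjections-suc N a (suc k)) ⟩
      binomialSurjections (suc N) a (suc k) ∎

  binomialDescents≡binomialSurjections : ∀ N k a → k ≤ N → a ≤ N →
    binomialDescents N a (N ∸ k) ≡ binomialSurjections N a k
  binomialDescents≡binomialSurjections zero    zero zero z≤n z≤n = refl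
  binomialDescents≡binomialSurjections (suc N) =
    binomialDescents-step N (binomialDescents≡binomialSurjections N)

open Counting

open import Data.Integer using (ℤ; +_; -_; _+_; _*_)
open import Data.Integer.Tactic.RingSolver using (solve-∀)
import Data.Nat.Tactic.RingSolver as ℕSolver

sgn-+ : ∀ m n → sgn (m ℕ.+ n) ≡ sgn m * sgn n
sgn-+ zero    n = sym (ℤP.*-identityˡ (sgn n))
sgn-+ (suc m) n = trans (cong -_ (sgn-+ m n)) (ℤP.neg-distribˡ-* (sgn m) (sgn n))

sgn*sgn : ∀ n → sgn n * sgn n ≡ + 1
sgn*sgn zero    = refl
sgn*sgn (suc n) = trans (neg*neg (sgn n)) (sgn*sgn n)
  where
  neg*neg : ∀ x → - x * - x ≡ x * x
  neg*neg = solve-∀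

sgn-cancel : ∀ n x → sgn n * (sgn n * x) ≡ x
sgn-cancel n x =
  trans (sym (ℤP.*-assoc (sgn n) (sgn n) x)) (trans (cong (_* x) (sgn*sgn n)) (ℤP.*-identityˡ x))

sgn-parity : ∀ {X P} c M → X ℕ.+ c ≡ P ℕ.+ (M ℕ.+ M) → sgn X ≡ sgn P * sgn c
sgn-parity {X} {P} c M X+c≡ = begin
  sgn X                          ≡⟨ sym (sgn-cancel c (sgn X)) ⟩
  sgn c * (sgn c * sgn X)        ≡⟨ cong (sgn c *_) (trans (ℤP.*-comm (sgn c) (sgn X)) (sym (sgn-+ X c))) ⟩
  sgn c * sgn (X ℕ.+ c)          ≡⟨ cong (λ t → sgn c * sgn t) X+c≡ ⟩
  sgn c * sgn (P ℕ.+ (M ℕ.+ M))  ≡⟨ cong (sgn c *_) (trans (sgn-+ P (M ℕ.+ M)) (cong (sgn P *_) even)) ⟩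
  sgn c * (sgn P * + 1)          ≡⟨ cong (sgn c *_) (ℤP.*-identityʳ (sgn P)) ⟩
  sgn c * sgn P                  ≡⟨ ℤP.*-comm (sgn c) (sgn P) ⟩
  sgn P * sgn c                  ∎
  where
  open ≡-Reasoning
  even = trans (sgn-+ M M) (sgn*sgn M)

×≡+* : ∀ n x → n ℤ∑.× x ≡ + n * x
×≡+* zero    x = sym (ℤP.*-zeroˡ x)
×≡+* (suc n) x = begin
  x + n ℤ∑.× x           ≡⟨ cong (λ t → x + t) (×≡+* n x) ⟩
  x + + n * x            ≡⟨ cong (_+ + n * x) (sym (ℤP.*-identityˡ x)) ⟩
  + 1 * x + + n * x      ≡⟨ sym (ℤP.*-distribʳ-+ x (+ 1) (+ n)) ⟩
  + suc n * x            ∎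
  where open ≡-Reasoning

binomialSum-neg : ∀ r (f : ℕ → ℤ) → ℤ∑.binomialSum r (λ i → - f i) ≡ - ℤ∑.binomialSum r f
binomialSum-neg zero    f = refl
binomialSum-neg (suc r) f =
  trans (cong₂ _+_ (binomialSum-neg r (f ∘ suc)) (binomialSum-neg r f))
        (sym (ℤP.neg-distrib-+ (ℤ∑.binomialSum r (f ∘ suc)) (ℤ∑.binomialSum r f)))

alternating-C-orthogonality : ∀ a b →
  ℤ∑.binomialSum b (λ c → sgn c * + (c C a)) ≡ sgn a * + 𝟙 (a ℕ.≟ b)
alternating-C-orthogonality zero    zero    = refl
alternating-C-orthogonality (suc a) zero    = sym (ℤP.*-zeroʳ (sgn (suc a)))
alternating-C-orthogonality zero    (suc b) = begin
  ℤ∑.binomialSum b (λ c → - sgn c * + 1) + K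
    ≡⟨ cong (_+ K) (trans (ℤ∑.binomialSum-cong b (λ c → sym (ℤP.neg-distribˡ-* (sgn c) (+ 1))))
                          (binomialSum-neg b _)) ⟩
  - K + K ≡⟨ ℤP.+-inverseˡ K ⟩
  + 0     ∎
  where
  open ≡-Reasoning
  K = ℤ∑.binomialSum b (λ c → sgn c * + (c C 0))
alternating-C-orthogonality (suc a) (suc b) = begin
  ℤ∑.binomialSum b (λ c → - sgn c * + (suc c C suc a)) + K (suc a)
    ≡⟨ cong (_+ K (suc a)) (trans (ℤ∑.binomialSum-cong b pascal)
         (trans (binomialSum-neg b _) (cong -_ (ℤ∑.binomialSum-distrib-+ b _ _)))) ⟩
  - (K a + K (suc a)) + K (suc a)
    ≡⟨ cancel (K a) (K (suc a)) ⟩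
  - K a
    ≡⟨ cong -_ (alternating-C-orthogonality a b) ⟩
  - (sgn a * + 𝟙 (a ℕ.≟ b))
    ≡⟨ ℤP.neg-distribˡ-* (sgn a) _ ⟩
  sgn (suc a) * + 𝟙 (a ℕ.≟ b)
    ≡⟨ cong (λ t → sgn (suc a) * + t) (𝟙-⇔ (a ℕ.≟ b) (suc a ℕ.≟ suc b) (mk⇔ (cong suc) ℕP.suc-injective)) ⟩
  sgn (suc a) * + 𝟙 (suc a ℕ.≟ suc b) ∎
  where
  open ≡-Reasoning
  K = λ a′ → ℤ∑.binomialSum b (λ c → sgn c * + (c C a′))
  pascal : ∀ c → - sgn c * + (suc c C suc a) ≡ - (sgn c * + (c C a) + sgn c * + (c C suc a))
  pascal c = begin
    - sgn c * + (suc c C suc a)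
      ≡⟨ sym (ℤP.neg-distribˡ-* (sgn c) _) ⟩
    - (sgn c * + (suc c C suc a))
      ≡⟨ cong (λ t → - (sgn c * + t)) (sym (nCk+nC[k+1]≡[n+1]C[k+1] c a)) ⟩
    - (sgn c * (+ (c C a) + + (c C suc a)))
      ≡⟨ cong -_ (ℤP.*-distribˡ-+ (sgn c) (+ (c C a)) _) ⟩
    - (sgn c * + (c C a) + sgn c * + (c C suc a)) ∎
  cancel : ∀ x y → - (x + y) + y ≡ - x
  cancel = solve-∀

∑-alternating-C : ∀ a b M → b ≤ M →
  ℤ∑.∑< (suc M) (λ c → + (b C c) * (sgn c * + (c C a))) ≡ sgn a * + 𝟙 (a ℕ.≟ b)
∑-alternating-C a b M b≤M = begin
  ℤ∑.∑< (suc M) f                                    ≡⟨ cong (λ n → ℤ∑.∑< n f) (sym (ℕP.m∸n+n≡m (s≤s b≤M))) ⟩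
  ℤ∑.∑< ((M ∸ b) ℕ.+ suc b) f                        ≡⟨ ℤ∑.∑<-extend (suc b) (M ∸ b) f beyond-b ⟩
  ℤ∑.∑< (suc b) f                                    ≡⟨ ℤ∑.∑<-cong (suc b) (λ c _ → sym (×≡+* (b C c) (g c))) ⟩
  ℤ∑.∑< (suc b) (λ c → (b C c) ℤ∑.× g c)            ≡⟨ sym (ℤ∑.binomialSum-closed b g) ⟩
  ℤ∑.binomialSum b g                                 ≡⟨ alternating-C-orthogonality a b ⟩
  sgn a * + 𝟙 (a ℕ.≟ b)                              ∎
  where
  open ≡-Reasoning
  g = λ c → sgn c * + (c C a)
  f = λ c → + (b C c) * g c
  beyond-b : ∀ c → suc b ≤ c → f c ≡ + 0
  beyond-b c b<c = trans (cong (λ t → + t * g c) (k>n⇒nCk≡0 b<c)) (ℤP.*-zeroˡ (g c))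

sgn-δ : ∀ a b → sgn b * (sgn a * + 𝟙 (a ℕ.≟ b)) ≡ + 𝟙 (a ℕ.≟ b)
sgn-δ a b with a ℕ.≟ b
... | yes refl = sgn-cancel a (+ 1)
... | no  _    = trans (cong (sgn b *_) (ℤP.*-zeroʳ (sgn a))) (ℤP.*-zeroʳ (sgn b))

Σ≡sum : ∀ {n} (f : Fin n → ℤ) → Σ f ≡ ℤ∑.sum f
Σ≡sum {zero}  f = refl
Σ≡sum {suc n} f = cong (λ t → f zero + t) (Σ≡sum (f ∘ suc))

Σ-cong : ∀ {n} {f g : Fin n → ℤ} → (∀ k → f k ≡ g k) → Σ f ≡ Σ g
Σ-cong {zero}  f≗g = refl
Σ-cong {suc n} f≗g = cong₂ _+_ (f≗g zero) (Σ-cong (f≗g ∘ suc))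

·-cong : ∀ {n} {M M′ N N′ : Mat n} → M ≡ᴹ M′ → N ≡ᴹ N′ → (M · N) ≡ᴹ (M′ · N′)
·-cong M≡M′ N≡N′ a b = Σ-cong (λ k → cong₂ _*_ (M≡M′ a k) (N≡N′ k b))

·-assoc : ∀ {n} (M N P : Mat n) → ((M · N) · P) ≡ᴹ (M · (N · P))
·-assoc M N P a b = begin
  Σ (λ k → Σ (λ j → M a j * N j k) * P k b)
    ≡⟨ Σ-cong (λ k → trans (cong (_* P k b) (Σ≡sum (λ j → M a j * N j k)))
                           (ℤ∑.*-distribʳ-sum (P k b) (λ j → M a j * N j k))) ⟩
  Σ (λ k → ℤ∑.sum (λ j → M a j * N j k * P k b))
    ≡⟨ Σ≡sum (λ k → ℤ∑.sum (λ j → M a j * N j k * P k b)) ⟩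
  ℤ∑.sum (λ k → ℤ∑.sum (λ j → M a j * N j k * P k b))
    ≡⟨ ℤ∑.∑-comm (λ k j → M a j * N j k * P k b) ⟩
  ℤ∑.sum (λ j → ℤ∑.sum (λ k → M a j * N j k * P k b))
    ≡⟨ ℤ∑.sum-cong-≋ (λ j → trans (ℤ∑.sum-cong-≋ (λ k → ℤP.*-assoc (M a j) (N j k) (P k b)))
                                  (sym (ℤ∑.*-distribˡ-sum (M a j) (λ k → N j k * P k b)))) ⟩
  ℤ∑.sum (λ j → M a j * ℤ∑.sum (λ k → N j k * P k b))
    ≡⟨ sym (trans (Σ≡sum (λ j → M a j * Σ (λ k → N j k * P k b)))
                  (ℤ∑.sum-cong-≋ (λ j → cong (M a j *_) (Σ≡sum (λ k → N j k * P k b))))) ⟩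
  Σ (λ j → M a j * Σ (λ k → N j k * P k b)) ∎
  where open ≡-Reasoning

Id≡𝟙 : ∀ {n} (a b : Fin n) → Id a b ≡ + 𝟙 (a Fin.≟ b)
Id≡𝟙 a b with a Fin.≟ b
... | yes _ = refl
... | no  _ = refl

Id-· : ∀ {n} (M : Mat n) → (Id · M) ≡ᴹ M
Id-· {suc n} M a b = trans (Σ≡sum (λ k → Id a k * M k b)) (ℤ∑.sum-pick a (Id a) (λ k → M k b)
  (trans (Id≡𝟙 a a) (cong +_ (𝟙-yes (a Fin.≟ a) refl)))
  (λ k k≢a → trans (Id≡𝟙 a k) (cong +_ (𝟙-no (a Fin.≟ k) (k≢a ∘ sym)))))

T⁻¹ : (d : ℕ) → Mat (suc (suc d))
T⁻¹ d a b = + (toℕ b C (suc d ∸ toℕ a))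

toℕ≤pred : ∀ {n} (a : Fin (suc n)) → toℕ a ≤ n
toℕ≤pred a = ℕP.≤-pred (FinP.toℕ<n a)

Id≡𝟙-toℕ : ∀ {n} (a b : Fin n) → + 𝟙 (toℕ a ℕ.≟ toℕ b) ≡ Id a b
Id≡𝟙-toℕ a b =
  trans (cong +_ (𝟙-⇔ (toℕ a ℕ.≟ toℕ b) (a Fin.≟ b) (mk⇔ FinP.toℕ-injective (cong toℕ)))) (sym (Id≡𝟙 a b))

T·T⁻¹ : ∀ d → (T d · T⁻¹ d) ≡ᴹ Id
T·T⁻¹ d a b = begin
  Σ {suc N} (λ k → g (toℕ k))
    ≡⟨ Σ≡sum {suc N} (λ k → g (toℕ k)) ⟩
  ℤ∑.∑< (suc N) g
    ≡⟨ ℤ∑.∑<-reverse N g ⟩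
  ℤ∑.∑< (suc N) (λ c → g (N ∸ c))
    ≡⟨ ℤ∑.∑<-cong (suc N) (λ c c≤N → term c (ℕP.≤-pred c≤N)) ⟩
  ℤ∑.∑< (suc N) (λ c → sgn i * (+ (j C c) * (sgn c * + (c C i))))
    ≡⟨ ℤ∑.*-distribˡ-∑< (suc N) (sgn i) (λ c → + (j C c) * (sgn c * + (c C i))) ⟩
  sgn i * ℤ∑.∑< (suc N) (λ c → + (j C c) * (sgn c * + (c C i)))
    ≡⟨ cong (sgn i *_) (∑-alternating-C i j N (toℕ≤pred b)) ⟩
  sgn i * (sgn i * + 𝟙 (i ℕ.≟ j))
    ≡⟨ sgn-cancel i (+ 𝟙 (i ℕ.≟ j)) ⟩
  + 𝟙 (i ℕ.≟ j)
    ≡⟨ Id≡𝟙-toℕ a b ⟩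
  Id a b ∎
  where
  open ≡-Reasoning
  N = suc d
  i = toℕ a
  j = toℕ b
  g : ℕ → ℤ
  g k = sgn (d ℕ.+ i ℕ.+ k ℕ.+ 1) * + ((N ∸ k) C i) * + (j C (N ∸ k))
  exponent : ∀ c → c ≤ N → d ℕ.+ i ℕ.+ (N ∸ c) ℕ.+ 1 ℕ.+ c ≡ i ℕ.+ (N ℕ.+ N)
  exponent c c≤N = trans (normalise d i (N ∸ c) c) (cong (λ t → i ℕ.+ (N ℕ.+ t)) (ℕP.m∸n+n≡m c≤N))
    where
    normalise : ∀ d i u c → d ℕ.+ i ℕ.+ u ℕ.+ 1 ℕ.+ c ≡ i ℕ.+ (suc d ℕ.+ (u ℕ.+ c))
    normalise = ℕSolver.solve-∀
  term : ∀ c → c ≤ N → g (N ∸ c) ≡ sgn i * (+ (j C c) * (sgn c * + (c C i)))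
  term c c≤N rewrite ℕP.m∸[m∸n]≡n c≤N | sgn-parity c N (exponent c c≤N) =
    rearrange (sgn i) (sgn c) (+ (c C i)) (+ (j C c))
    where
    rearrange : ∀ x y z w → x * y * z * w ≡ x * (w * (y * z))
    rearrange = solve-∀

T⁻¹·T : ∀ d → (T⁻¹ d · T d) ≡ᴹ Id
T⁻¹·T d a b = begin
  Σ {suc N} (λ k → g (toℕ k))
    ≡⟨ Σ≡sum {suc N} (λ k → g (toℕ k)) ⟩
  ℤ∑.∑< (suc N) g
    ≡⟨ ℤ∑.∑<-cong (suc N) (λ k _ → term k) ⟩
  ℤ∑.∑< (suc N) (λ k → sgn j′ * (+ (j′ C k) * (sgn k * + (k C i′))))
    ≡⟨ ℤ∑.*-distribˡ-∑< (suc N) (sgn j′) (λ k → + (j′ C k) * (sgn k * + (k C i′))) ⟩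
  sgn j′ * ℤ∑.∑< (suc N) (λ k → + (j′ C k) * (sgn k * + (k C i′)))
    ≡⟨ cong (sgn j′ *_) (∑-alternating-C i′ j′ N (ℕP.m∸n≤m N j)) ⟩
  sgn j′ * (sgn i′ * + 𝟙 (i′ ℕ.≟ j′))
    ≡⟨ sgn-δ i′ j′ ⟩
  + 𝟙 (i′ ℕ.≟ j′)
    ≡⟨ cong +_ (𝟙-⇔ (i′ ℕ.≟ j′) (i ℕ.≟ j) (mk⇔ (ℕP.∸-cancelˡ-≡ (toℕ≤pred a) (toℕ≤pred b)) (cong (N ∸_)))) ⟩
  + 𝟙 (i ℕ.≟ j)
    ≡⟨ Id≡𝟙-toℕ a b ⟩
  Id a b ∎
  where
  open ≡-Reasoning
  N = suc d
  i = toℕ a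
  j = toℕ b
  i′ = N ∸ i
  j′ = N ∸ j
  g : ℕ → ℤ
  g k = + (k C i′) * (sgn (d ℕ.+ k ℕ.+ j ℕ.+ 1) * + (j′ C k))
  exponent : ∀ k → d ℕ.+ k ℕ.+ j ℕ.+ 1 ℕ.+ j′ ≡ k ℕ.+ (N ℕ.+ N)
  exponent k = trans (normalise d k j j′) (cong (λ t → k ℕ.+ (N ℕ.+ t)) (ℕP.m+[n∸m]≡n (toℕ≤pred b)))
    where
    normalise : ∀ d k j j′ → d ℕ.+ k ℕ.+ j ℕ.+ 1 ℕ.+ j′ ≡ k ℕ.+ (suc d ℕ.+ (j ℕ.+ j′))
    normalise = ℕSolver.solve-∀
  term : ∀ k → g k ≡ sgn j′ * (+ (j′ C k) * (sgn k * + (k C i′)))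
  term k rewrite sgn-parity j′ N (exponent k) = rearrange (+ (k C i′)) (sgn k) (sgn j′) (+ (j′ C k))
    where
    rearrange : ∀ x y z w → x * (y * z * w) ≡ z * (w * (y * x))
    rearrange = solve-∀

+∑< : ∀ n (f : ℕ → ℕ) → + ℕ∑.∑< n f ≡ ℤ∑.∑< n (λ i → + f i)
+∑< zero    f = refl
+∑< (suc n) f =
  trans (ℤP.pos-+ (f 0) (ℕ∑.∑< n (f ∘ suc))) (cong (λ t → + f 0 + t) (+∑< n (f ∘ suc)))

F≡surjections : ∀ d (k b : Fin (suc (suc d))) → F d k b ≡ + surjections (toℕ b) (toℕ k)
F≡surjections d zero    zero    = refl
F≡surjections d zero    (suc b) = refl
F≡surjections d (suc k) zero    = refl
F≡surjections d (suc k) (suc b) = cong +_ (chains≡surjections (toℕ k) (suc (toℕ b)))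

F·T⁻¹≡T⁻¹·H : ∀ d → (F d · T⁻¹ d) ≡ᴹ (T⁻¹ d · H d)
F·T⁻¹≡T⁻¹·H d k a = begin
  Σ {suc N} (λ b → F d k b * T⁻¹ d b a)
    ≡⟨ Σ-cong (λ b → trans (cong (_* T⁻¹ d b a) (F≡surjections d k b))
                           (sym (ℤP.pos-* (surjections (toℕ b) κ) (α C (N ∸ toℕ b))))) ⟩
  Σ {suc N} (λ b → + (surjections (toℕ b) κ ℕ.* (α C (N ∸ toℕ b))))
    ≡⟨ Σ≡sum {suc N} (λ b → + (surjections (toℕ b) κ ℕ.* (α C (N ∸ toℕ b)))) ⟩
  ℤ∑.∑< (suc N) (λ b → + (surjections b κ ℕ.* (α C (N ∸ b))))
    ≡⟨ sym (+∑< (suc N) (λ b → surjections b κ ℕ.* (α C (N ∸ b)))) ⟩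
  + binomialSurjections N α κ
    ≡⟨ cong +_ (sym (binomialDescents≡binomialSurjections N κ α (toℕ≤pred k) (toℕ≤pred a))) ⟩
  + binomialDescents N α (N ∸ κ)
    ≡⟨ +∑< (suc N) (λ i → (i C (N ∸ κ)) ℕ.* A′ N i α) ⟩
  ℤ∑.∑< (suc N) (λ i → + ((i C (N ∸ κ)) ℕ.* A′ N i α))
    ≡⟨ sym (Σ≡sum {suc N} (λ i → + ((toℕ i C (N ∸ κ)) ℕ.* A′ N (toℕ i) α))) ⟩
  Σ {suc N} (λ i → + ((toℕ i C (N ∸ κ)) ℕ.* A′ N (toℕ i) α))
    ≡⟨ Σ-cong {suc N} (λ i → ℤP.pos-* (toℕ i C (N ∸ κ)) (A′ N (toℕ i) α)) ⟩
  Σ (λ i → T⁻¹ d k i * H d i a) ∎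
  where
  open ≡-Reasoning
  N = suc d
  κ = toℕ k
  α = toℕ a

lemma2p7 : (d : ℕ) →
    Σ[ Tinv ∈ Mat (suc (suc d)) ]
    ((T d · Tinv) ≡ᴹ Id) × ((Tinv · T d) ≡ᴹ Id) × (((T d · F d) · Tinv) ≡ᴹ H d)
lemma2p7 d = T⁻¹ d , T·T⁻¹ d , T⁻¹·T d , conjugation
  where
  open ≡-Reasoning
  conjugation : ((T d · F d) · T⁻¹ d) ≡ᴹ H d
  conjugation a b = begin
    ((T d · F d) · T⁻¹ d) a b  ≡⟨ ·-assoc (T d) (F d) (T⁻¹ d) a b ⟩
    (T d · (F d · T⁻¹ d)) a b  ≡⟨ ·-cong {M = T d} (λ _ _ → refl) (F·T⁻¹≡T⁻¹·H d) a b ⟩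
    (T d · (T⁻¹ d · H d)) a b  ≡⟨ sym (·-assoc (T d) (T⁻¹ d) (H d) a b) ⟩
    ((T d · T⁻¹ d) · H d) a b  ≡⟨ ·-cong {N = H d} (T·T⁻¹ d) (λ _ _ → refl) a b ⟩
    (Id · H d) a b             ≡⟨ Id-· (H d) a b ⟩
    H d a b                    ∎
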